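{- Let $\lambda=(\lambda_1\ge\cdots\ge\lambda_n\ge0)$ be a partition with $n$ (possibly zero) parts. Then the Gelfand–Tsetlin polytope $\mathrm{GT}(\lambda)$ is integrally equivalent to the flow polytope $\mathcal{F}_{G_\lambda}$.
   Context: $\mathrm{GT}(\lambda)\subset\mathbb{R}^{\binom{n+1}{2}}$ is the set of nonnegative triangular arrays $(x_{ij})_{1\le i\le j\le n}$ with $x_{1j}=\lambda_j$ for $1\le j\le n$ and $x_{i-1,j-1}\ge x_{ij}\ge x_{i-1,j}$ for $2\le i\le j\le n$. Flow polytopes: for a finite directed acyclic multigraph $G$ and a netflow assignment $a\colon V(G)\to\mathbb{Z}$ with $\sum_v a(v)=0$, the flow polytope $\mathcal{F}_G=\mathcal{F}_G(a)$ is the set of $f\in\mathbb{R}_{\ge0}^{E(G)}$ such that for every vertex $v$, $\sum_{e\text{ into }v}f(e)+a(v)=\sum_{e\text{ out of }v}f(e)$. The flow network $G_\lambda$: if $n=1$, $G_\lambda$ is a single vertex and $\mathcal{F}_{G_\lambda}=\{0\}$. If $n\ge2$, $G_\lambda$ has vertices $v_{ij}$ ($2\le i\le j\le n$), $v_{i,i-1}$ ($3\le i\le n+2$), $v_{i,n+1}$ ($3\le i\le n+1$), and edges $(v_{ij},v_{i+1,j})$ for $2\le i\le j\le n$; $(v_{i,n+1},v_{i+1,n+1})$ for $3\le i\le n+1$; $(v_{ij},v_{i+1,j+1})$ for $2\le i\le j\le n$; $(v_{i,i-1},v_{i+1,i})$ for $3\le i\le n+1$. Netflow: $\lambda_{j-1}-\lambda_j$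 at $v_{2j}$ for $2\le j\le n$, $\lambda_n-\lambda_1$ at $v_{n+2,n+1}$, and $0$ at all other vertices. Two integral polytopes $\mathcal{P}\subset\mathbb{R}^d$, $\mathcal{Q}\subset\mathbb{R}^m$ are integrally equivalent if there is an affine map $\varphi\colon\mathbb{R}^d\to\mathbb{R}^m$ restricting to a bijection $\mathcal{P}\to\mathcal{Q}$ and to a bijection $\mathbb{Z}^d\cap\mathrm{aff}(\mathcal{P})\to\mathbb{Z}^m\cap\mathrm{aff}(\mathcal{Q})$.
   Formalization: The polytopes $\mathrm{GT}(\lambda)$ and $\mathcal{F}_{G_\lambda}$ are taken as their sets of rational points, and the affine map of integral equivalence is ℚ-affine, acting on ℚ^d rather than ℝ^d. -}

module Defs where

open import Data.Nat as ℕ using (ℕ; zero; suc; _∸_)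
open import Data.Integer as ℤ using (ℤ; +_)
open import Data.Rational as ℚ using (ℚ; 0ℚ; 1ℚ)
open import Data.Fin using (Fin; toℕ) renaming (zero to fzero; suc to fsuc)
open import Data.Vec using (Vec; lookup)
open import Data.List as List using (List; []; _∷_; _++_; concatMap; map; upTo; length)
open import Data.List.Membership.Propositional using (_∈_)
open import Data.List.Relation.Unary.All using (All)
open import Data.Product using (Σ; ∃; _×_; _,_; proj₁; proj₂)
open import Data.Product.Properties using (≡-dec)
open import Data.Bool using (Bool; true; false; if_then_else_; _∧_)
open import Relation.Binary.PropositionalEquality using (_≡_)
open import Relation.Nullary.Decidable using (⌊_⌋)

Pt : Set → Set
Pt I = I → ℚ

_≐_ : {I : Set} → Pt I → Pt I → Set
x ≐ y = ∀ i → x i ≡ y i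

affComb : {I : Set} → ℚ → Pt I → Pt I → Pt I
affComb t x y i = t ℚ.* x i ℚ.+ (1ℚ ℚ.- t) ℚ.* y i

ℤ→ℚ : ℤ → ℚ
ℤ→ℚ z = z ℚ./ 1

ℕ→ℚ : ℕ → ℚ
ℕ→ℚ n = ℤ→ℚ (+ n)

IsIntegral : {I : Set} → Pt I → Set
IsIntegral {I} x = ∀ i → ∃ λ (z : ℤ) → x i ≡ ℤ→ℚ z

sumList : List ℚ → ℚ
sumList = List.foldr ℚ._+_ 0ℚ

sumFin : (m : ℕ) → (Fin m → ℚ) → ℚ
sumFin zero    f = 0ℚ
sumFin (suc m) f = f fzero ℚ.+ sumFin m (λ k → f (fsuc k))

AffineHull : {I : Set} → (Pt I → Set) → Pt I → Set
AffineHull {I} P x =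
  Σ (List (ℚ × Pt I)) λ ws →
      All (λ w → P (proj₂ w)) ws
    × sumList (map proj₁ ws) ≡ 1ℚ
    × (∀ i → x i ≡ sumList (map (λ w → proj₁ w ℚ.* proj₂ w i) ws))

-- Affine maps ℚ^I → ℚ^J: respect pointwise equality and preserve
-- (binary, hence all) affine combinations.
IsAffine : {I J : Set} → (Pt I → Pt J) → Set
IsAffine {I} {J} φ =
    (∀ x y → x ≐ y → φ x ≐ φ y)
  × (∀ (t : ℚ) x y → φ (affComb t x y) ≐ affComb t (φ x) (φ y))

BijectiveBetween : {I J : Set} → (Pt I → Pt J) → (Pt I → Set) → (Pt J → Set) → Set
BijectiveBetween {I} {J} φ A B =
    (∀ x → A x → B (φ x))
  × (∀ x y → A x → A y → φ x ≐ φ y → x ≐ y)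
  × (∀ y → B y → ∃ λ x → A x × φ x ≐ y)

LatticeOfHull : {I : Set} → (Pt I → Set) → Pt I → Set
LatticeOfHull P x = IsIntegral x × AffineHull P x

IntegrallyEquivalent : {I J : Set} → (Pt I → Set) → (Pt J → Set) → Set
IntegrallyEquivalent {I} {J} P Q =
  Σ (Pt I → Pt J) λ φ →
      IsAffine φ
    × BijectiveBetween φ P Q
    × BijectiveBetween φ (LatticeOfHull P) (LatticeOfHull Q)

IsPartition : {n : ℕ} → Vec ℕ n → Set
IsPartition {n} λv = ∀ (k l : Fin n) → toℕ k ℕ.≤ toℕ l → lookup λv l ℕ.≤ lookup λv k

-- 1-based access λ_j (value 0 outside 1 ≤ j ≤ n; only used inside)
part : {n : ℕ} → Vec ℕ n → ℕ → ℕ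
part {zero}  λv j = 0
part {suc n} λv zero = 0
part {suc n} (a Data.Vec.∷ λv) (suc zero) = a
part {suc n} (a Data.Vec.∷ λv) (suc (suc j)) = part λv (suc j)

record GTIdx (n : ℕ) : Set where
  constructor gtIdx
  field
    i j : ℕ
    1≤i : 1 ℕ.≤ i
    i≤j : i ℕ.≤ j
    j≤n : j ℕ.≤ n
open GTIdx public

GT : {n : ℕ} → Vec ℕ n → Pt (GTIdx n) → Set
GT {n} λv x =
    (∀ p → 0ℚ ℚ.≤ x p)
  × (∀ p → i p ≡ 1 → x p ≡ ℕ→ℚ (part λv (j p)))
  × (∀ p q → i q ≡ suc (i p) → j q ≡ suc (j p) → x q ℚ.≤ x p)
  × (∀ p q → i q ≡ suc (i p) → j q ≡ j p → x p ℚ.≤ x q)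

-- Flow polytopes of a finite directed multigraph with vertex list V,
-- edge list E (edge k goes from proj₁ (E[k]) to proj₂ (E[k])), and
-- netflow a. Flows are points of ℚ^{Fin |E|}.

Vtx : Set
Vtx = ℕ × ℕ

record FlowNetwork : Set where
  constructor network
  field
    vertices : List Vtx
    edges    : List (Vtx × Vtx)
    netflow  : Vtx → ℚ
open FlowNetwork public

_==_ : Vtx → Vtx → Bool
u == v = ⌊ ≡-dec ℕ._≟_ ℕ._≟_ u v ⌋

FlowPolytope : (G : FlowNetwork) → Pt (Fin (length (edges G))) → Set
FlowPolytope G f =
    (∀ e → 0ℚ ℚ.≤ f e)
  × (∀ v → v ∈ vertices G →
       sumFin m (λ e → if proj₂ (List.lookup (edges G) e) == v then f e else 0ℚ)
         ℚ.+ netflow G v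
       ≡ sumFin m (λ e → if proj₁ (List.lookup (edges G) e) == v then f e else 0ℚ))
  where m = length (edges G)

-- [a, a+1, …, b] (empty if b < a)
range : ℕ → ℕ → List ℕ
range a b = map (a ℕ.+_) (upTo (suc b ∸ a))

Gλ-vertices : ℕ → List Vtx
Gλ-vertices n =
     concatMap (λ j → map (λ i → (i , j)) (range 2 j)) (range 2 n)
  ++ map (λ i → (i , i ∸ 1)) (range 3 (n ℕ.+ 2))
  ++ map (λ i → (i , n ℕ.+ 1)) (range 3 (n ℕ.+ 1))

Gλ-edges : ℕ → List (Vtx × Vtx)
Gλ-edges n =
     concatMap (λ j → map (λ i → ((i , j) , (suc i , j))) (range 2 j)) (range 2 n)
  ++ map (λ i → ((i , n ℕ.+ 1) , (suc i , n ℕ.+ 1))) (range 3 (n ℕ.+ 1))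
  ++ concatMap (λ j → map (λ i → ((i , j) , (suc i , suc j))) (range 2 j)) (range 2 n)
  ++ map (λ i → ((i , i ∸ 1) , (suc i , i))) (range 3 (n ℕ.+ 1))

Gλ-netflow : {n : ℕ} → Vec ℕ n → Vtx → ℚ
Gλ-netflow {n} λv (i , j) =
  if ⌊ i ℕ.≟ 2 ⌋ ∧ ⌊ 2 ℕ.≤? j ⌋ ∧ ⌊ j ℕ.≤? n ⌋
  then ℕ→ℚ (part λv (j ∸ 1)) ℚ.- ℕ→ℚ (part λv j)
  else (if (i , j) == (n ℕ.+ 2 , n ℕ.+ 1)
        then ℕ→ℚ (part λv n) ℚ.- ℕ→ℚ (part λv 1)
        else 0ℚ)

Gλ : {n : ℕ} → Vec ℕ n → FlowNetwork
Gλ {n} λv = network (Gλ-vertices n) (Gλ-edges n) (Gλ-netflow λv)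

module Submission where

-- Extend a pattern x by x_{i,n+1} := x_{1n} and x_{i+1,i} := x_{11}, and put the flow
-- x_{i-1,j-1} - x_{ij} on each edge v_{ij} → v_{i+1,j} and x_{ij} - x_{i-1,j} on each edge
-- v_{ij} → v_{i+1,j+1}.  These flows are nonnegative exactly when x interlaces, and
-- conservation at a vertex is a telescoping identity; at the sources and the sink the
-- netflow is matched by the first row x_{1j} = λ_j.  Conversely a flow f determines the
-- pattern x_{ij} = λ_j + Σ_{k=2}^{i} f(v_{kj} → v_{k+1,j+1}).  Both maps are affine with
-- integer coefficients and inverse to each other on the affine hulls, so they also match
-- the lattice points of the hulls.

open import Defs
open import Data.Nat as ℕ using (ℕ; zero; suc; _∸_; z≤n; s≤s)
open import Data.Vec using (Vec)
import Data.Nat.Properties as ℕP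
import Data.Nat.Coprimality as Coprime
open import Data.Integer as ℤ using (ℤ; +_)
import Data.Integer.Properties as ℤP
open import Data.Rational as ℚ using (ℚ; 0ℚ; 1ℚ)
import Data.Rational.Properties as ℚP
open import Data.Rational.Unnormalised as ℚᵘ using (mkℚᵘ; *≡*)
import Data.Rational.Unnormalised.Properties as ℚᵘP
open import Data.Rational.Solver
open import Data.Fin as Fin using (Fin) renaming (zero to fzero; suc to fsuc)
import Data.Fin.Properties as FinP
open import Data.Maybe using (Maybe; just; nothing)
open import Data.List as List using (List; []; _∷_; _++_; concatMap; map; length)
open import Data.List.Membership.Propositional using (_∈_; _∉_; find; lose)
open import Data.List.Membership.Propositional.Properties
open import Data.List.Relation.Unary.All as All using (All; []; _∷_)
import Data.List.Relation.Unary.Any as Any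
import Data.List.Relation.Unary.Any.Properties as AnyP
import Data.List.Relation.Unary.All.Properties as AllP
import Data.List.Properties as ListP
open import Data.List.Relation.Unary.Unique.Propositional using (Unique)
open import Data.List.Relation.Unary.AllPairs using ([]; _∷_)
import Data.List.Relation.Unary.Unique.Propositional.Properties as Unique
open import Data.List.Relation.Binary.Disjoint.Propositional using (Disjoint)
open import Data.Product using (∃; ∃₂; _×_; _,_; proj₁; proj₂)
open import Data.Product.Properties using (≡-dec)
open import Data.Sum using (_⊎_; inj₁; inj₂)
open import Data.Bool using (Bool; true; false; if_then_else_)
open import Data.Empty using (⊥-elim)
open import Relation.Nullary using (¬_; yes; no; does)
open import Relation.Binary.PropositionalEquality
open import Relation.Binary.Definitions using (DecidableEquality)
open import Function using (_∘_; case_of_)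

open +-*-Solver

ℕ→ℚ-mono : ∀ {a b} → a ℕ.≤ b → ℕ→ℚ a ℚ.≤ ℕ→ℚ b
ℕ→ℚ-mono {a} {b} a≤b rewrite ℚP.normalize-coprime (Coprime.sym (Coprime.1-coprimeTo a))
                           | ℚP.normalize-coprime (Coprime.sym (Coprime.1-coprimeTo b)) =
  ℚ.*≤* (subst₂ ℤ._≤_ (sym (ℤP.*-identityʳ (+ a))) (sym (ℤP.*-identityʳ (+ b))) (ℤ.+≤+ a≤b))

0≤ℕ→ℚ : ∀ a → 0ℚ ℚ.≤ ℕ→ℚ a
0≤ℕ→ℚ a = ℕ→ℚ-mono {0} {a} z≤n

0≤q-p⇒p≤q : ∀ {p q} → 0ℚ ℚ.≤ q ℚ.- p → p ℚ.≤ q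
0≤q-p⇒p≤q {p} {q} h = subst₂ ℚ._≤_ (solve 1 (λ p → con 0ℚ :+ p := p) refl p)
  (solve 2 (λ p q → (q :- p) :+ p := q) refl p q) (ℚP.+-monoˡ-≤ p h)

p≤q⇒0≤q-p : ∀ {p q} → p ℚ.≤ q → 0ℚ ℚ.≤ q ℚ.- p
p≤q⇒0≤q-p {p} {q} h = subst (ℚ._≤ q ℚ.- p) (ℚP.+-inverseʳ p) (ℚP.+-monoˡ-≤ (ℚ.- p) h)

0≤p+q : ∀ {p q} → 0ℚ ℚ.≤ p → 0ℚ ℚ.≤ q → 0ℚ ℚ.≤ p ℚ.+ q
0≤p+q {p} {q} 0≤p 0≤q = subst (ℚ._≤ p ℚ.+ q) (ℚP.+-identityˡ 0ℚ) (ℚP.+-mono-≤ 0≤p 0≤q)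

p≤p+q : ∀ {p q} → 0ℚ ℚ.≤ q → p ℚ.≤ p ℚ.+ q
p≤p+q {p} {q} 0≤q = subst₂ ℚ._≤_ (ℚP.+-identityʳ p) refl (ℚP.+-monoʳ-≤ p 0≤q)

IsInt : ℚ → Set
IsInt q = ∃ λ (z : ℤ) → q ≡ ℤ→ℚ z

toℚᵘ-ℤ→ℚ : ∀ z → ℚ.toℚᵘ (ℤ→ℚ z) ℚᵘ.≃ mkℚᵘ z 0
toℚᵘ-ℤ→ℚ z = ℚP.toℚᵘ-fromℚᵘ (mkℚᵘ z 0)

ℤ→ℚ-+ : ∀ a b → ℤ→ℚ a ℚ.+ ℤ→ℚ b ≡ ℤ→ℚ (a ℤ.+ b)
ℤ→ℚ-+ a b = ℚP.toℚᵘ-injective (begin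
  ℚ.toℚᵘ (ℤ→ℚ a ℚ.+ ℤ→ℚ b)            ≈⟨ ℚP.toℚᵘ-homo-+ (ℤ→ℚ a) (ℤ→ℚ b) ⟩
  ℚ.toℚᵘ (ℤ→ℚ a) ℚᵘ.+ ℚ.toℚᵘ (ℤ→ℚ b) ≈⟨ ℚᵘP.+-cong (toℚᵘ-ℤ→ℚ a) (toℚᵘ-ℤ→ℚ b) ⟩
  mkℚᵘ a 0 ℚᵘ.+ mkℚᵘ b 0              ≈⟨ *≡* (trans (ℤP.*-identityʳ _)
                                            (trans (cong₂ ℤ._+_ (ℤP.*-identityʳ a) (ℤP.*-identityʳ b))
                                                   (sym (ℤP.*-identityʳ (a ℤ.+ b))))) ⟩
  mkℚᵘ (a ℤ.+ b) 0                     ≈⟨ ℚᵘP.≃-sym (toℚᵘ-ℤ→ℚ (a ℤ.+ b)) ⟩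
  ℚ.toℚᵘ (ℤ→ℚ (a ℤ.+ b))              ∎)
  where open ℚᵘP.≃-Reasoning

ℤ→ℚ-neg : ∀ a → ℚ.- ℤ→ℚ a ≡ ℤ→ℚ (ℤ.- a)
ℤ→ℚ-neg a = ℚP.toℚᵘ-injective
  (ℚᵘP.≃-trans (ℚP.toℚᵘ-homo‿- (ℤ→ℚ a))
  (ℚᵘP.≃-trans (ℚᵘP.-‿cong (toℚᵘ-ℤ→ℚ a)) (ℚᵘP.≃-sym (toℚᵘ-ℤ→ℚ (ℤ.- a)))))

IsInt-+ : ∀ {p q} → IsInt p → IsInt q → IsInt (p ℚ.+ q)
IsInt-+ (a , refl) (b , refl) = a ℤ.+ b , ℤ→ℚ-+ a b

IsInt-- : ∀ {p q} → IsInt p → IsInt q → IsInt (p ℚ.- q)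
IsInt-- p∈ℤ (b , refl) = IsInt-+ p∈ℤ (ℤ.- b , ℤ→ℚ-neg b)

IsInt-0 : IsInt 0ℚ
IsInt-0 = + 0 , refl

IsInt-ℕ : ∀ a → IsInt (ℕ→ℚ a)
IsInt-ℕ a = + a , refl

sumFin-cong : ∀ m {f g : Fin m → ℚ} → (∀ e → f e ≡ g e) → sumFin m f ≡ sumFin m g
sumFin-cong zero    f≗g = refl
sumFin-cong (suc m) f≗g = cong₂ ℚ._+_ (f≗g fzero) (sumFin-cong m (λ e → f≗g (fsuc e)))

sumFin-+ : ∀ m (f g : Fin m → ℚ) → sumFin m (λ e → f e ℚ.+ g e) ≡ sumFin m f ℚ.+ sumFin m g
sumFin-+ zero    f g = sym (ℚP.+-identityˡ 0ℚ)
sumFin-+ (suc m) f g rewrite sumFin-+ m (λ e → f (fsuc e)) (λ e → g (fsuc e)) =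
  solve 4 (λ a b s t → (a :+ b) :+ (s :+ t) := (a :+ s) :+ (b :+ t)) refl
    (f fzero) (g fzero) (sumFin m (λ e → f (fsuc e))) (sumFin m (λ e → g (fsuc e)))

sumFin-zero : ∀ m {f : Fin m → ℚ} → (∀ e → f e ≡ 0ℚ) → sumFin m f ≡ 0ℚ
sumFin-zero zero    f≗0 = refl
sumFin-zero (suc m) f≗0 = trans (cong₂ ℚ._+_ (f≗0 fzero) (sumFin-zero m (λ e → f≗0 (fsuc e)))) (ℚP.+-identityˡ 0ℚ)

sumFin-single : ∀ m {f : Fin m → ℚ} e₀ → (∀ e → e ≢ e₀ → f e ≡ 0ℚ) → sumFin m f ≡ f e₀
sumFin-single (suc m) {f} fzero     others≡0 =
  trans (cong (f fzero ℚ.+_) (sumFin-zero m (λ e → others≡0 (fsuc e) (λ ())))) (ℚP.+-identityʳ (f fzero))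
sumFin-single (suc m) {f} (fsuc e₀) others≡0 =
  trans (cong₂ ℚ._+_ (others≡0 fzero (λ ()))
                     (sumFin-single m e₀ (λ e e≢e₀ → others≡0 (fsuc e) (e≢e₀ ∘ FinP.suc-injective))))
        (ℚP.+-identityˡ (f (fsuc e₀)))

sumFin-nonneg : ∀ m {f : Fin m → ℚ} → (∀ e → 0ℚ ℚ.≤ f e) → 0ℚ ℚ.≤ sumFin m f
sumFin-nonneg zero    f≥0 = ℚP.≤-refl
sumFin-nonneg (suc m) f≥0 = 0≤p+q (f≥0 fzero) (sumFin-nonneg m (λ e → f≥0 (fsuc e)))

sumFin-integral : ∀ m {f : Fin m → ℚ} → (∀ e → IsInt (f e)) → IsInt (sumFin m f)
sumFin-integral zero    f∈ℤ = IsInt-0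
sumFin-integral (suc m) f∈ℤ = IsInt-+ (f∈ℤ fzero) (sumFin-integral m (λ e → f∈ℤ (fsuc e)))

-- Affine combinations and integral equivalence

module _ {A : Set} where

  Σw : List (ℚ × A) → (A → ℚ) → ℚ
  Σw ws g = sumList (map (λ w → proj₁ w ℚ.* g (proj₂ w)) ws)

  totalWeight : List (ℚ × A) → ℚ
  totalWeight ws = sumList (map proj₁ ws)

  Σw-congᴬ : ∀ {P : A → Set} {ws} {g h : A → ℚ} → All (λ w → P (proj₂ w)) ws →
             (∀ z → P z → g z ≡ h z) → Σw ws g ≡ Σw ws h
  Σw-congᴬ []         g≗h = refl
  Σw-congᴬ {ws = w ∷ _} (pw ∷ pws) g≗h = cong₂ ℚ._+_ (cong (proj₁ w ℚ.*_) (g≗h _ pw)) (Σw-congᴬ pws g≗h)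

  Σw-+ : ∀ ws (g h : A → ℚ) → Σw ws (λ z → g z ℚ.+ h z) ≡ Σw ws g ℚ.+ Σw ws h
  Σw-+ []       g h = sym (ℚP.+-identityˡ 0ℚ)
  Σw-+ (w ∷ ws) g h rewrite Σw-+ ws g h =
    solve 5 (λ t a b x y → t :* (a :+ b) :+ (x :+ y) := (t :* a :+ x) :+ (t :* b :+ y)) refl
      (proj₁ w) (g (proj₂ w)) (h (proj₂ w)) (Σw ws g) (Σw ws h)

  Σw-- : ∀ ws (g h : A → ℚ) → Σw ws (λ z → g z ℚ.- h z) ≡ Σw ws g ℚ.- Σw ws h
  Σw-- []       g h = sym (ℚP.+-inverseʳ 0ℚ)
  Σw-- (w ∷ ws) g h rewrite Σw-- ws g h =
    solve 5 (λ t a b x y → t :* (a :- b) :+ (x :- y) := (t :* a :+ x) :- (t :* b :+ y)) refl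
      (proj₁ w) (g (proj₂ w)) (h (proj₂ w)) (Σw ws g) (Σw ws h)

  Σw-const : ∀ ws c → Σw ws (λ _ → c) ≡ totalWeight ws ℚ.* c
  Σw-const []       c = sym (ℚP.*-zeroˡ c)
  Σw-const (w ∷ ws) c rewrite Σw-const ws c =
    solve 3 (λ t s c → t :* c :+ s :* c := (t :+ s) :* c) refl (proj₁ w) (totalWeight ws) c

  Σw-zero : ∀ ws → Σw ws (λ _ → 0ℚ) ≡ 0ℚ
  Σw-zero ws = trans (Σw-const ws 0ℚ) (ℚP.*-zeroʳ (totalWeight ws))

  Σw-affine-const : ∀ ws c → totalWeight ws ≡ 1ℚ → Σw ws (λ _ → c) ≡ c
  Σw-affine-const ws c total≡1 = trans (Σw-const ws c) (trans (cong (ℚ._* c) total≡1) (ℚP.*-identityˡ c))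

sumFin-Σw : ∀ {A : Set} m ws (g : A → Fin m → ℚ) →
            sumFin m (λ e → Σw ws (λ z → g z e)) ≡ Σw ws (λ z → sumFin m (g z))
sumFin-Σw zero    ws g = sym (Σw-zero ws)
sumFin-Σw (suc m) ws g =
  trans (cong (Σw ws (λ z → g z fzero) ℚ.+_) (sumFin-Σw m ws (λ z e → g z (fsuc e))))
        (sym (Σw-+ ws (λ z → g z fzero) (λ z → sumFin m (λ e → g z (fsuc e)))))

module _ {I : Set} where

  _IsCombinationOf_ : Pt I → List (ℚ × Pt I) → Set
  y IsCombinationOf ws = ∀ i → y i ≡ Σw ws (λ z → z i)

  PreservesAffineCombinations : (Pt I → ℚ) → Set
  PreservesAffineCombinations ℓ =
    ∀ ws y → totalWeight ws ≡ 1ℚ → y IsCombinationOf ws → ℓ y ≡ Σw ws ℓ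

  preserves-const : ∀ c → PreservesAffineCombinations (λ _ → c)
  preserves-const c ws _ total≡1 _ = sym (Σw-affine-const ws c total≡1)

  coordinate : Maybe I → Pt I → ℚ
  coordinate (just i) x = x i
  coordinate nothing  x = 0ℚ

  preserves-coordinate : ∀ c → PreservesAffineCombinations (coordinate c)
  preserves-coordinate (just i) ws y _ y≡ = y≡ i
  preserves-coordinate nothing  ws y _ _  = sym (Σw-zero ws)

  coordinate-integral : ∀ c x → IsIntegral x → IsInt (coordinate c x)
  coordinate-integral (just i) x x∈ℤ = x∈ℤ i
  coordinate-integral nothing  x _   = IsInt-0

  preserves-sum : ∀ {ℓ ℓ′} → PreservesAffineCombinations ℓ → PreservesAffineCombinations ℓ′ →
                PreservesAffineCombinations (λ y → ℓ y ℚ.+ ℓ′ y)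
  preserves-sum {ℓ} {ℓ′} pℓ pℓ′ ws y total≡1 y≡ =
    trans (cong₂ ℚ._+_ (pℓ ws y total≡1 y≡) (pℓ′ ws y total≡1 y≡)) (sym (Σw-+ ws ℓ ℓ′))

  preserves-difference : ∀ {ℓ ℓ′} → PreservesAffineCombinations ℓ → PreservesAffineCombinations ℓ′ →
                PreservesAffineCombinations (λ y → ℓ y ℚ.- ℓ′ y)
  preserves-difference {ℓ} {ℓ′} pℓ pℓ′ ws y total≡1 y≡ =
    trans (cong₂ ℚ._-_ (pℓ ws y total≡1 y≡) (pℓ′ ws y total≡1 y≡)) (sym (Σw-- ws ℓ ℓ′))

  ∈⇒∈hull : ∀ {P : Pt I → Set} {x} → P x → AffineHull P x
  ∈⇒∈hull {x = x} x∈P =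
    (1ℚ , x) ∷ [] , x∈P ∷ [] , ℚP.+-identityʳ 1ℚ ,
    λ i → sym (trans (ℚP.+-identityʳ _) (ℚP.*-identityˡ (x i)))

  hull-preserves-equation : ∀ {P : Pt I → Set} {ℓ ℓ′ y} →
    PreservesAffineCombinations ℓ → PreservesAffineCombinations ℓ′ →
    (∀ z → P z → ℓ z ≡ ℓ′ z) → AffineHull P y → ℓ y ≡ ℓ′ y
  hull-preserves-equation {y = y} pℓ pℓ′ eqn (ws , all∈P , total≡1 , y≡) =
    trans (pℓ ws y total≡1 y≡) (trans (Σw-congᴬ all∈P eqn) (sym (pℓ′ ws y total≡1 y≡)))

preserves-maskedSum : ∀ m (b : Fin m → Bool) →
  PreservesAffineCombinations (λ f → sumFin m (λ e → if b e then f e else 0ℚ))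
preserves-maskedSum m b ws y _ y≡ =
  trans (sumFin-cong m masked) (sumFin-Σw m ws (λ z e → if b e then z e else 0ℚ))
  where
    masked : ∀ e → (if b e then y e else 0ℚ) ≡ Σw ws (λ z → if b e then z e else 0ℚ)
    masked e with b e
    ... | true  = y≡ e
    ... | false = sym (Σw-zero ws)

module _ {I J : Set} (φ : Pt I → Pt J) (φ-affine : ∀ j → PreservesAffineCombinations (λ x → φ x j)) where

  resp-≐ : ∀ x y → x ≐ y → φ x ≐ φ y
  resp-≐ x y x≐y j = begin
    φ x j                    ≡⟨ φ-affine j ((1ℚ , y) ∷ []) x (ℚP.+-identityʳ 1ℚ) x≡ ⟩
    1ℚ ℚ.* φ y j ℚ.+ 0ℚ      ≡⟨ solve 1 (λ a → con 1ℚ :* a :+ con 0ℚ := a) refl (φ y j) ⟩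
    φ y j                    ∎
    where
      open ≡-Reasoning
      x≡ : x IsCombinationOf ((1ℚ , y) ∷ [])
      x≡ i = trans (x≐y i) (solve 1 (λ a → a := con 1ℚ :* a :+ con 0ℚ) refl (y i))

  preserves⇒IsAffine : IsAffine φ
  preserves⇒IsAffine = resp-≐ , binary
    where
      binary : ∀ t x y → φ (affComb t x y) ≐ affComb t (φ x) (φ y)
      binary t x y j =
        trans (φ-affine j ((t , x) ∷ (1ℚ ℚ.- t , y) ∷ []) (affComb t x y) total≡1
                (λ i → solve 3 (λ t a b → t :* a :+ (con 1ℚ :- t) :* b
                                          := t :* a :+ ((con 1ℚ :- t) :* b :+ con 0ℚ)) refl t (x i) (y i)))
              (solve 3 (λ t a b → t :* a :+ ((con 1ℚ :- t) :* b :+ con 0ℚ)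
                                  := t :* a :+ (con 1ℚ :- t) :* b) refl t (φ x j) (φ y j))
        where
          total≡1 : t ℚ.+ ((1ℚ ℚ.- t) ℚ.+ 0ℚ) ≡ 1ℚ
          total≡1 = solve 1 (λ t → t :+ ((con 1ℚ :- t) :+ con 0ℚ) := con 1ℚ) refl t

  preserves-hull : ∀ {P : Pt I → Set} {Q : Pt J → Set} → (∀ x → P x → Q (φ x)) →
                   ∀ x → AffineHull P x → AffineHull Q (φ x)
  preserves-hull P⇒Q x (ws , all∈P , total≡1 , x≡) =
    map image ws ,
    AllP.map⁺ (All.map (P⇒Q _) all∈P) ,
    trans (cong sumList (sym (ListP.map-∘ ws))) total≡1 ,
    λ j → trans (φ-affine j ws x total≡1 x≡) (cong sumList (ListP.map-∘ ws))
    where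
      image : ℚ × Pt I → ℚ × Pt J
      image (t , z) = t , φ z

record IntegralAffineInverses {I J : Set} (P : Pt I → Set) (Q : Pt J → Set) : Set where
  field
    to   : Pt I → Pt J
    from : Pt J → Pt I
    to-affine     : ∀ j → PreservesAffineCombinations (λ x → to x j)
    from-affine   : ∀ i → PreservesAffineCombinations (λ y → from y i)
    to-integral   : ∀ x → IsIntegral x → IsIntegral (to x)
    from-integral : ∀ y → IsIntegral y → IsIntegral (from y)
    to-maps       : ∀ x → P x → Q (to x)
    from-maps     : ∀ y → Q y → P (from y)
    from∘to       : ∀ x → AffineHull P x → from (to x) ≐ x
    to∘from       : ∀ y → AffineHull Q y → to (from y) ≐ y

integrallyEquivalent : ∀ {I J : Set} {P : Pt I → Set} {Q : Pt J → Set} →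
                       IntegralAffineInverses P Q → IntegrallyEquivalent P Q
integrallyEquivalent {I} {J} {P} {Q} inverses =
  to , preserves⇒IsAffine to to-affine ,
  (to-maps , injectiveOn ∈⇒∈hull , surjective) ,
  (lattice-to , injectiveOn proj₂ , lattice-from)
  where
    open IntegralAffineInverses inverses

    injectiveOn : ∀ {A : Pt I → Set} → (∀ {x} → A x → AffineHull P x) →
                  ∀ x y → A x → A y → to x ≐ to y → x ≐ y
    injectiveOn A⊆hull x y x∈A y∈A tx≐ty i =
      trans (sym (from∘to x (A⊆hull x∈A) i))
            (trans (resp-≐ from from-affine (to x) (to y) tx≐ty i) (from∘to y (A⊆hull y∈A) i))

    surjective : ∀ y → Q y → ∃ λ x → P x × to x ≐ y
    surjective y y∈Q = from y , from-maps y y∈Q , to∘from y (∈⇒∈hull y∈Q)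

    lattice-to : ∀ x → LatticeOfHull P x → LatticeOfHull Q (to x)
    lattice-to x (x∈ℤ , x∈hull) = to-integral x x∈ℤ , preserves-hull to to-affine to-maps x x∈hull

    lattice-from : ∀ y → LatticeOfHull Q y → ∃ λ x → LatticeOfHull P x × to x ≐ y
    lattice-from y (y∈ℤ , y∈hull) =
      from y , (from-integral y y∈ℤ , preserves-hull from from-affine from-maps y y∈hull) , to∘from y y∈hull

-- Values of a function on the positions of a list

lookup-injective : ∀ {A : Set} {xs : List A} → Unique xs →
                   ∀ e e′ → List.lookup xs e ≡ List.lookup xs e′ → e ≡ e′
lookup-injective {xs = _ ∷ _} _          fzero     fzero     _  = refl
lookup-injective {xs = _ ∷ _} (x∉ ∷ _)   fzero     (fsuc e′) eq = ⊥-elim (All.lookup x∉ (∈-lookup e′) eq)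
lookup-injective {xs = _ ∷ _} (x∉ ∷ _)   (fsuc e)  fzero     eq = ⊥-elim (All.lookup x∉ (∈-lookup e) (sym eq))
lookup-injective {xs = _ ∷ _} (_ ∷ uniq) (fsuc e)  (fsuc e′) eq = cong fsuc (lookup-injective uniq e e′ eq)

module _ {A : Set} (_≟_ : DecidableEquality A) (xs : List A) where

  valueAt : (Fin (length xs) → ℚ) → A → ℚ
  valueAt f a = sumFin (length xs) (λ e → if does (List.lookup xs e ≟ a) then f e else 0ℚ)

  valueAt-lookup : Unique xs → ∀ f e → valueAt f (List.lookup xs e) ≡ f e
  valueAt-lookup uniq f e = trans (sumFin-single (length xs) e others) (at e)
    where
      others : ∀ e′ → e′ ≢ e → (if does (List.lookup xs e′ ≟ List.lookup xs e) then f e′ else 0ℚ) ≡ 0ℚ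
      others e′ e′≢e with List.lookup xs e′ ≟ List.lookup xs e
      ... | yes eq = ⊥-elim (e′≢e (lookup-injective uniq e′ e eq))
      ... | no _   = refl
      at : ∀ e → (if does (List.lookup xs e ≟ List.lookup xs e) then f e else 0ℚ) ≡ f e
      at e with List.lookup xs e ≟ List.lookup xs e
      ... | yes _ = refl
      ... | no ≢  = ⊥-elim (≢ refl)

  valueAt-∉ : ∀ f {a} → a ∉ xs → valueAt f a ≡ 0ℚ
  valueAt-∉ f {a} a∉xs = sumFin-zero (length xs) term
    where
      term : ∀ e → (if does (List.lookup xs e ≟ a) then f e else 0ℚ) ≡ 0ℚ
      term e with List.lookup xs e ≟ a
      ... | yes refl = ⊥-elim (a∉xs (∈-lookup e))
      ... | no _     = refl

  valueAt-nonneg : ∀ {f} → (∀ e → 0ℚ ℚ.≤ f e) → ∀ a → 0ℚ ℚ.≤ valueAt f a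
  valueAt-nonneg {f} f≥0 a = sumFin-nonneg (length xs) term
    where
      term : ∀ e → 0ℚ ℚ.≤ (if does (List.lookup xs e ≟ a) then f e else 0ℚ)
      term e with does (List.lookup xs e ≟ a)
      ... | true  = f≥0 e
      ... | false = ℚP.≤-refl

  valueAt-integral : ∀ {f} → IsIntegral f → ∀ a → IsInt (valueAt f a)
  valueAt-integral {f} f∈ℤ a = sumFin-integral (length xs) term
    where
      term : ∀ e → IsInt (if does (List.lookup xs e ≟ a) then f e else 0ℚ)
      term e with does (List.lookup xs e ≟ a)
      ... | true  = f∈ℤ e
      ... | false = IsInt-0

  preserves-valueAt : ∀ a → PreservesAffineCombinations (λ f → valueAt f a)
  preserves-valueAt a = preserves-maskedSum (length xs) (λ e → does (List.lookup xs e ≟ a))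

  maskedSum-two : ∀ (b : A → Bool) f {k₁ k₂} → k₁ ≢ k₂ → b k₁ ≡ true → b k₂ ≡ true →
    (∀ e → b (List.lookup xs e) ≡ true → List.lookup xs e ≡ k₁ ⊎ List.lookup xs e ≡ k₂) →
    sumFin (length xs) (λ e → if b (List.lookup xs e) then f e else 0ℚ) ≡ valueAt f k₁ ℚ.+ valueAt f k₂
  maskedSum-two b f {k₁} {k₂} k₁≢k₂ bk₁ bk₂ only =
    trans (sumFin-cong (length xs) split) (sumFin-+ (length xs) (term k₁) (term k₂))
    where
      term : A → Fin (length xs) → ℚ
      term k e = if does (List.lookup xs e ≟ k) then f e else 0ℚ
      split : ∀ e → (if b (List.lookup xs e) then f e else 0ℚ) ≡ term k₁ e ℚ.+ term k₂ e
      split e with b (List.lookup xs e) in be | List.lookup xs e ≟ k₁ | List.lookup xs e ≟ k₂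
      ... | true  | yes refl | yes refl = ⊥-elim (k₁≢k₂ refl)
      ... | true  | yes _    | no _     = sym (ℚP.+-identityʳ (f e))
      ... | true  | no _     | yes _    = sym (ℚP.+-identityˡ (f e))
      ... | false | yes refl | _        = case (trans (sym be) bk₁) of λ ()
      ... | false | no _     | yes refl = case (trans (sym be) bk₂) of λ ()
      ... | false | no _     | no _     = sym (ℚP.+-identityˡ 0ℚ)
      ... | true  | no ≢₁    | no ≢₂ with only e be
      ...   | inj₁ eq = ⊥-elim (≢₁ eq)
      ...   | inj₂ eq = ⊥-elim (≢₂ eq)

-- The network G_λ

range⁻ : ∀ a b {x} → x ∈ range a b → a ℕ.≤ x × x ℕ.≤ b
range⁻ a b {x} x∈ with ∈-map⁻ (a ℕ.+_) x∈
... | k , k∈ , refl = ℕP.m≤m+n a k , ℕP.≤-pred (a+k<b (∈-upTo⁻ k∈))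
  where
    a+k<b : ∀ {a b k} → k ℕ.< b ∸ a → a ℕ.+ k ℕ.< b
    a+k<b {zero}  {b}     k<b = k<b
    a+k<b {suc a} {suc b} k<b = s≤s (a+k<b {a} {b} k<b)

range⁺ : ∀ a b {x} → a ℕ.≤ x → x ℕ.≤ b → x ∈ range a b
range⁺ a b {x} a≤x x≤b = subst (_∈ range a b) (ℕP.m+[n∸m]≡n a≤x)
  (∈-map⁺ (a ℕ.+_) (∈-upTo⁺ (ℕP.∸-monoˡ-< (s≤s x≤b) a≤x)))

range-unique : ∀ a b → Unique (range a b)
range-unique a b = Unique.map⁺ (ℕP.+-cancelˡ-≡ a _ _) (Unique.upTo⁺ _)

concatMap-unique : ∀ {A B : Set} (g : A → List B) {xs : List A} → Unique xs →
  (∀ a → Unique (g a)) → (∀ {a a′ v} → v ∈ g a → v ∈ g a′ → a ≡ a′) → Unique (concatMap g xs)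
concatMap-unique g {[]}     _           _        _        = []
concatMap-unique g {x ∷ xs} (x∉ ∷ uniq) g-unique g-disjoint =
  Unique.++⁺ (g-unique x) (concatMap-unique g uniq g-unique g-disjoint) disjoint
  where
    disjoint : Disjoint (g x) (concatMap g xs)
    disjoint (v∈gx , v∈rest) with find (∈-concatMap⁻ g {xs = xs} v∈rest)
    ... | y , y∈xs , v∈gy = All.lookup x∉ y∈xs (g-disjoint v∈gx v∈gy)

n+1≡1+n : ∀ n → n ℕ.+ 1 ≡ suc n
n+1≡1+n n = ℕP.+-comm n 1

n+2≡2+n : ∀ n → n ℕ.+ 2 ≡ suc (suc n)
n+2≡2+n n = ℕP.+-comm n 2

module Network (n : ℕ) where

  Inner : ℕ → ℕ → Set
  Inner i j = 2 ℕ.≤ i × i ℕ.≤ j × j ℕ.≤ n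

  grid : ∀ {B : Set} → (ℕ → ℕ → B) → List B
  grid g = concatMap (λ j → map (λ i → g i j) (range 2 j)) (range 2 n)

  ∈grid⁻ : ∀ {B : Set} (g : ℕ → ℕ → B) {v} → v ∈ grid g → ∃₂ λ i j → Inner i j × v ≡ g i j
  ∈grid⁻ g v∈ with find (∈-concatMap⁻ (λ j → map (λ i → g i j) (range 2 j)) {xs = range 2 n} v∈)
  ... | j , j∈ , v∈row with ∈-map⁻ (λ i → g i j) v∈row
  ... | i , i∈ , refl = i , j , (proj₁ (range⁻ 2 j i∈) , proj₂ (range⁻ 2 j i∈) , proj₂ (range⁻ 2 n j∈)) , refl

  ∈grid⁺ : ∀ {B : Set} (g : ℕ → ℕ → B) {i j} → Inner i j → g i j ∈ grid g
  ∈grid⁺ g {i} {j} (2≤i , i≤j , j≤n) =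
    ∈-concatMap⁺ (λ j → map (λ i → g i j) (range 2 j)) {xs = range 2 n}
      (lose (range⁺ 2 n (ℕP.≤-trans 2≤i i≤j) j≤n) (∈-map⁺ (λ i → g i j) (range⁺ 2 j 2≤i i≤j)))

  grid-unique : ∀ {B : Set} (g : ℕ → ℕ → B) →
    (∀ {i j i′ j′} → g i j ≡ g i′ j′ → i ≡ i′ × j ≡ j′) → Unique (grid g)
  grid-unique g g-injective =
    concatMap-unique _ (range-unique 2 n)
      (λ j → Unique.map⁺ (proj₁ ∘ g-injective) (range-unique 2 j))
      (λ {j} {j′} v∈ v∈′ → same-column (∈-map⁻ (λ i → g i j) v∈) (∈-map⁻ (λ i → g i j′) v∈′))
    where
      same-column : ∀ {j j′ v} → (∃ λ i → _ × v ≡ g i j) → (∃ λ i → _ × v ≡ g i j′) → j ≡ j′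
      same-column (_ , _ , refl) (_ , _ , eq) = proj₂ (g-injective eq)

  ↓ ↘ : ℕ → ℕ → Vtx × Vtx
  ↓ i j = (i , j) , (suc i , j)
  ↘ i j = (i , j) , (suc i , suc j)

  Is↓ Is↘ : ℕ → ℕ → Set
  Is↓ i j = Inner i j ⊎ (j ≡ suc n × 3 ℕ.≤ i × i ℕ.≤ suc n)
  Is↘ i j = Inner i j ⊎ (i ≡ suc j × 3 ℕ.≤ i × i ℕ.≤ suc n)

  data IsEdge : Vtx × Vtx → Set where
    down : ∀ {i j} → Is↓ i j → IsEdge (↓ i j)
    diag : ∀ {i j} → Is↘ i j → IsEdge (↘ i j)

  ↓≢↘ : ∀ {i j i′ j′} → ↓ i j ≢ ↘ i′ j′
  ↓≢↘ eq = ℕP.1+n≢n (sym (trans (sym (cong (proj₂ ∘ proj₁) eq)) (cong (proj₂ ∘ proj₂) eq)))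

  source-injective : ∀ {i j i′ j′} {t t′ : Vtx} → _≡_ {A = Vtx × Vtx} ((i , j) , t) ((i′ , j′) , t′) →
                     i ≡ i′ × j ≡ j′
  source-injective refl = refl , refl

  edgeList : List (Vtx × Vtx)
  edgeList = Gλ-edges n

  column↓ diagonal↘ : List (Vtx × Vtx)
  column↓   = map (λ i → ↓ i (n ℕ.+ 1)) (range 3 (n ℕ.+ 1))
  diagonal↘ = map (λ i → (i , i ∸ 1) , (suc i , i)) (range 3 (n ℕ.+ 1))

  ∈column↓⁻ : ∀ {ed} → ed ∈ column↓ → ∃ λ i → 3 ℕ.≤ i × i ℕ.≤ suc n × ed ≡ ↓ i (suc n)
  ∈column↓⁻ ed∈ with ∈-map⁻ (λ i → ↓ i (n ℕ.+ 1)) ed∈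
  ... | i , i∈ , refl rewrite n+1≡1+n n with range⁻ 3 (suc n) i∈
  ... | 3≤i , i≤n+1 = i , 3≤i , i≤n+1 , refl

  ∈diagonal↘⁻ : ∀ {ed} → ed ∈ diagonal↘ → ∃ λ j → 3 ℕ.≤ suc j × suc j ℕ.≤ suc n × ed ≡ ↘ (suc j) j
  ∈diagonal↘⁻ ed∈ with ∈-map⁻ (λ i → (i , i ∸ 1) , (suc i , i)) ed∈
  ... | i , i∈ , refl with range⁻ 3 (n ℕ.+ 1) i∈
  ... | 3≤i@(s≤s _) , i≤n+1 = _ , 3≤i , subst (i ℕ.≤_) (n+1≡1+n n) i≤n+1 , refl

  IsEdge⇒∈edgeList : ∀ {ed} → IsEdge ed → ed ∈ edgeList
  IsEdge⇒∈edgeList (down (inj₁ inner)) = ∈-++⁺ˡ (∈grid⁺ ↓ inner)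
  IsEdge⇒∈edgeList (down {i} (inj₂ (refl , 3≤i , i≤n+1))) =
    ∈-++⁺ʳ (grid ↓) (∈-++⁺ˡ (subst (λ k → ↓ i k ∈ column↓) (n+1≡1+n n)
      (∈-map⁺ (λ i → ↓ i (n ℕ.+ 1)) (range⁺ 3 (n ℕ.+ 1) 3≤i (subst (i ℕ.≤_) (sym (n+1≡1+n n)) i≤n+1)))))
  IsEdge⇒∈edgeList (diag (inj₁ inner)) = ∈-++⁺ʳ (grid ↓) (∈-++⁺ʳ column↓ (∈-++⁺ˡ (∈grid⁺ ↘ inner)))
  IsEdge⇒∈edgeList (diag {j = j} (inj₂ (refl , 3≤i , i≤n+1))) =
    ∈-++⁺ʳ (grid ↓) (∈-++⁺ʳ column↓ (∈-++⁺ʳ (grid ↘)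
      (∈-map⁺ (λ i → (i , i ∸ 1) , (suc i , i)) (range⁺ 3 (n ℕ.+ 1) 3≤i (subst (suc j ℕ.≤_) (sym (n+1≡1+n n)) i≤n+1)))))

  ∈edgeList⇒IsEdge : ∀ {ed} → ed ∈ edgeList → IsEdge ed
  ∈edgeList⇒IsEdge ed∈ with ∈-++⁻ (grid ↓) ed∈
  ... | inj₁ ∈inner with ∈grid⁻ ↓ ∈inner
  ...   | _ , _ , inner , refl = down (inj₁ inner)
  ∈edgeList⇒IsEdge ed∈ | inj₂ ed∈′ with ∈-++⁻ column↓ ed∈′
  ... | inj₁ ∈column with ∈column↓⁻ ∈column
  ...   | _ , 3≤i , i≤n+1 , refl = down (inj₂ (refl , 3≤i , i≤n+1))
  ∈edgeList⇒IsEdge ed∈ | inj₂ ed∈′ | inj₂ ed∈″ with ∈-++⁻ (grid ↘) ed∈″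
  ... | inj₁ ∈inner with ∈grid⁻ ↘ ∈inner
  ...   | _ , _ , inner , refl = diag (inj₁ inner)
  ∈edgeList⇒IsEdge ed∈ | inj₂ ed∈′ | inj₂ ed∈″ | inj₂ ∈diagonal with ∈diagonal↘⁻ ∈diagonal
  ...   | _ , 3≤i , i≤n+1 , refl = diag (inj₂ (refl , 3≤i , i≤n+1))

  private
    ∈↘-blocks : ∀ {ed} → ed ∈ grid ↘ ++ diagonal↘ → ∃₂ λ i j → ed ≡ ↘ i j
    ∈↘-blocks ed∈ with ∈-++⁻ (grid ↘) ed∈
    ... | inj₁ ∈inner with ∈grid⁻ ↘ ∈inner
    ...   | i , j , _ , eq = i , j , eq
    ∈↘-blocks ed∈ | inj₂ ∈diagonal with ∈diagonal↘⁻ ∈diagonal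
    ...   | j , _ , _ , eq = suc j , j , eq

  edgeList-unique : Unique edgeList
  edgeList-unique =
    Unique.++⁺ (grid-unique ↓ source-injective)
      (Unique.++⁺ (Unique.map⁺ (proj₁ ∘ source-injective) (range-unique 3 (n ℕ.+ 1)))
        (Unique.++⁺ (grid-unique ↘ source-injective)
                    (Unique.map⁺ (proj₁ ∘ source-injective) (range-unique 3 (n ℕ.+ 1)))
                    inner↘#diagonal↘)
        column↓#↘)
      inner↓#rest
    where
      inner↘#diagonal↘ : Disjoint (grid ↘) diagonal↘
      inner↘#diagonal↘ (∈inner , ∈diagonal) with ∈grid⁻ ↘ ∈inner | ∈diagonal↘⁻ ∈diagonal
      ... | _ , _ , (_ , i≤j , _) , refl | _ , _ , _ , eq with source-injective eq
      ...   | refl , refl = ℕP.1+n≰n i≤j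

      column↓#↘ : Disjoint column↓ (grid ↘ ++ diagonal↘)
      column↓#↘ (∈column , ∈↘) with ∈column↓⁻ ∈column | ∈↘-blocks ∈↘
      ... | _ , _ , _ , refl | _ , _ , eq = ↓≢↘ eq

      inner↓#rest : Disjoint (grid ↓) (column↓ ++ grid ↘ ++ diagonal↘)
      inner↓#rest (∈inner , ∈rest) with ∈grid⁻ ↓ ∈inner | ∈-++⁻ column↓ ∈rest
      ... | _ , _ , (_ , _ , j≤n) , refl | inj₁ ∈column with ∈column↓⁻ ∈column
      ...   | _ , _ , _ , eq with source-injective eq
      ...     | refl , refl = ℕP.1+n≰n j≤n
      inner↓#rest (∈inner , ∈rest) | _ , _ , _ , refl | inj₂ ∈↘ with ∈↘-blocks ∈↘
      ...   | _ , _ , eq = ↓≢↘ eq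

  _≟ᴱ_ : DecidableEquality (Vtx × Vtx)
  _≟ᴱ_ = ≡-dec (≡-dec ℕ._≟_ ℕ._≟_) (≡-dec ℕ._≟_ ℕ._≟_)

  #edges : ℕ
  #edges = length edgeList

  flowAt : (Fin #edges → ℚ) → Vtx × Vtx → ℚ
  flowAt = valueAt _≟ᴱ_ edgeList

  flowAt-lookup : ∀ f e → flowAt f (List.lookup edgeList e) ≡ f e
  flowAt-lookup = valueAt-lookup _≟ᴱ_ edgeList edgeList-unique

  flowAt-edge : ∀ (g : Vtx × Vtx → ℚ) {ed} → ed ∈ edgeList → flowAt (g ∘ List.lookup edgeList) ed ≡ g ed
  flowAt-edge g ed∈ = subst (λ ed → flowAt (g ∘ List.lookup edgeList) ed ≡ g ed)
    (sym (AnyP.lookup-index ed∈)) (flowAt-lookup (g ∘ List.lookup edgeList) (Any.index ed∈))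

  flowAt-↓ : ∀ f {i j} → ¬ Is↓ i j → flowAt f (↓ i j) ≡ 0ℚ
  flowAt-↓ f ¬edge = valueAt-∉ _≟ᴱ_ edgeList f (λ ∈edges → ¬edge (is↓ (∈edgeList⇒IsEdge ∈edges)))
    where
      is↓ : ∀ {i j} → IsEdge (↓ i j) → Is↓ i j
      is↓ (down edge) = edge

  flowAt-↘ : ∀ f {i j} → ¬ Is↘ i j → flowAt f (↘ i j) ≡ 0ℚ
  flowAt-↘ f ¬edge = valueAt-∉ _≟ᴱ_ edgeList f (λ ∈edges → ¬edge (is↘ (∈edgeList⇒IsEdge ∈edges)))
    where
      is↘ : ∀ {i j} → IsEdge (↘ i j) → Is↘ i j
      is↘ (diag edge) = edge

  ==-refl : ∀ v → v == v ≡ true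
  ==-refl v with ≡-dec ℕ._≟_ ℕ._≟_ v v
  ... | yes _  = refl
  ... | no v≢v = ⊥-elim (v≢v refl)

  ==⇒≡ : ∀ u v → u == v ≡ true → u ≡ v
  ==⇒≡ u v u==v with ≡-dec ℕ._≟_ ℕ._≟_ u v
  ==⇒≡ u v _  | yes u≡v = u≡v
  ==⇒≡ u v () | no _

  inflow outflow : (Fin #edges → ℚ) → Vtx → ℚ
  inflow  f v = sumFin #edges (λ e → if proj₂ (List.lookup edgeList e) == v then f e else 0ℚ)
  outflow f v = sumFin #edges (λ e → if proj₁ (List.lookup edgeList e) == v then f e else 0ℚ)

  inflow-split : ∀ f a b → inflow f (suc a , suc b) ≡ flowAt f (↓ a (suc b)) ℚ.+ flowAt f (↘ a b)
  inflow-split f a b = maskedSum-two _≟ᴱ_ edgeList (λ ed → proj₂ ed == (suc a , suc b)) f ↓≢↘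
    (==-refl _) (==-refl _) (λ e → into (∈edgeList⇒IsEdge (∈-lookup e)))
    where
      into : ∀ {ed} → IsEdge ed → proj₂ ed == (suc a , suc b) ≡ true → ed ≡ ↓ a (suc b) ⊎ ed ≡ ↘ a b
      into (down _) ends with ==⇒≡ _ _ ends
      ... | refl = inj₁ refl
      into (diag _) ends with ==⇒≡ _ _ ends
      ... | refl = inj₂ refl

  outflow-split : ∀ f a b → outflow f (suc a , suc b) ≡ flowAt f (↓ (suc a) (suc b)) ℚ.+ flowAt f (↘ (suc a) (suc b))
  outflow-split f a b = maskedSum-two _≟ᴱ_ edgeList (λ ed → proj₁ ed == (suc a , suc b)) f ↓≢↘
    (==-refl _) (==-refl _) (λ e → outof (∈edgeList⇒IsEdge (∈-lookup e)))
    where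
      outof : ∀ {ed} → IsEdge ed → proj₁ ed == (suc a , suc b) ≡ true →
              ed ≡ ↓ (suc a) (suc b) ⊎ ed ≡ ↘ (suc a) (suc b)
      outof (down _) starts with ==⇒≡ _ _ starts
      ... | refl = inj₁ refl
      outof (diag _) starts with ==⇒≡ _ _ starts
      ... | refl = inj₂ refl

  flowAt-↓-source : ∀ f j → flowAt f (↓ 1 j) ≡ 0ℚ
  flowAt-↓-source f j = flowAt-↓ f λ { (inj₁ (s≤s () , _)) ; (inj₂ (_ , s≤s () , _)) }

  flowAt-↘-source : ∀ f j → flowAt f (↘ 1 j) ≡ 0ℚ
  flowAt-↘-source f j = flowAt-↘ f λ { (inj₁ (s≤s () , _)) ; (inj₂ (_ , s≤s () , _)) }

  flowAt-↘-2-1 : ∀ f → flowAt f (↘ 2 1) ≡ 0ℚ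
  flowAt-↘-2-1 f = flowAt-↘ f λ { (inj₁ (_ , s≤s () , _)) ; (inj₂ (_ , s≤s (s≤s ()) , _)) }

  flowAt-↓-2-column : ∀ f → flowAt f (↓ 2 (suc n)) ≡ 0ℚ
  flowAt-↓-2-column f = flowAt-↓ f λ { (inj₁ (_ , _ , n+1≤n)) → ℕP.1+n≰n n+1≤n ; (inj₂ (_ , s≤s (s≤s ()) , _)) }

  flowAt-↓-below-diagonal : ∀ f j → flowAt f (↓ (suc (suc j)) (suc j)) ≡ 0ℚ
  flowAt-↓-below-diagonal f j =
    flowAt-↓ f λ { (inj₁ (_ , j+2≤j+1 , _))     → ℕP.1+n≰n j+2≤j+1
                 ; (inj₂ (refl , _ , j+2≤j+1)) → ℕP.1+n≰n j+2≤j+1 }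

  flowAt-↘-beyond-column : ∀ f i → flowAt f (↘ i (suc n)) ≡ 0ℚ
  flowAt-↘-beyond-column f i =
    flowAt-↘ f λ { (inj₁ (_ , _ , n+1≤n)) → ℕP.1+n≰n n+1≤n ; (inj₂ (refl , _ , n+2≤n+1)) → ℕP.1+n≰n n+2≤n+1 }

  data IsVertex : Vtx → Set where
    inner    : ∀ {a b} → 1 ℕ.≤ a → a ℕ.≤ b → suc b ℕ.≤ n → IsVertex (suc a , suc b)
    diagonal : ∀ {b} → 1 ℕ.≤ b → b ℕ.≤ n → IsVertex (suc (suc b) , suc b)
    column   : ∀ {a} → 2 ℕ.≤ a → a ℕ.≤ n → IsVertex (suc a , suc n)

  vertexList : List Vtx
  vertexList = Gλ-vertices n

  diagonalVertices columnVertices : List Vtx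
  diagonalVertices = map (λ i → i , i ∸ 1) (range 3 (n ℕ.+ 2))
  columnVertices   = map (λ i → i , n ℕ.+ 1) (range 3 (n ℕ.+ 1))

  ∈vertexList⇒IsVertex : ∀ {v} → v ∈ vertexList → IsVertex v
  ∈vertexList⇒IsVertex v∈ with ∈-++⁻ (grid _,_) v∈
  ... | inj₁ ∈inner with ∈grid⁻ _,_ ∈inner
  ...   | _ , _ , (s≤s 1≤a , s≤s a≤b , b<n) , refl = inner 1≤a a≤b b<n
  ∈vertexList⇒IsVertex v∈ | inj₂ v∈′ with ∈-++⁻ diagonalVertices v∈′
  ... | inj₁ ∈diagonal with ∈-map⁻ (λ i → i , i ∸ 1) ∈diagonal
  ...   | i , i∈ , refl with range⁻ 3 (n ℕ.+ 2) i∈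
  ...     | s≤s (s≤s 1≤b) , i≤n+2 = diagonal 1≤b (ℕP.≤-pred (ℕP.≤-pred (subst (i ℕ.≤_) (n+2≡2+n n) i≤n+2)))
  ∈vertexList⇒IsVertex v∈ | inj₂ v∈′ | inj₂ ∈column with ∈-map⁻ (λ i → i , n ℕ.+ 1) ∈column
  ...   | _ , i∈ , refl with range⁻ 3 (n ℕ.+ 1) i∈
  ...     | s≤s 2≤a , i≤n+1 rewrite n+1≡1+n n = column 2≤a (ℕP.≤-pred i≤n+1)

  IsVertex⇒∈vertexList : ∀ {v} → IsVertex v → v ∈ vertexList
  IsVertex⇒∈vertexList (inner 1≤a a≤b b<n) = ∈-++⁺ˡ (∈grid⁺ _,_ (s≤s 1≤a , s≤s a≤b , b<n))
  IsVertex⇒∈vertexList (diagonal {b} 1≤b b≤n) =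
    ∈-++⁺ʳ (grid _,_) (∈-++⁺ˡ (∈-map⁺ (λ i → i , i ∸ 1)
      (range⁺ 3 (n ℕ.+ 2) (s≤s (s≤s 1≤b)) (subst (suc (suc b) ℕ.≤_) (sym (n+2≡2+n n)) (s≤s (s≤s b≤n))))))
  IsVertex⇒∈vertexList (column {a} 2≤a a≤n) =
    ∈-++⁺ʳ (grid _,_) (∈-++⁺ʳ diagonalVertices (subst (λ k → (suc a , k) ∈ columnVertices) (n+1≡1+n n)
      (∈-map⁺ (λ i → i , n ℕ.+ 1) (range⁺ 3 (n ℕ.+ 1) (s≤s 2≤a) (subst (suc a ℕ.≤_) (sym (n+1≡1+n n)) (s≤s a≤n))))))

-- Gelfand–Tsetlin patterns as flows

module GelfandTsetlin {n : ℕ} (λv : Vec ℕ n) where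
  open Network n

  λ′ : ℕ → ℚ
  λ′ j = ℕ→ℚ (part λv j)

  net : Vtx → ℚ
  net = Gλ-netflow λv

  net-source : ∀ {b} → 1 ℕ.≤ b → suc b ℕ.≤ n → net (2 , suc b) ≡ λ′ b ℚ.- λ′ (suc b)
  net-source {b} 1≤b b<n with 2 ℕ.≤? suc b | suc b ℕ.≤? n
  ... | yes _    | yes _   = refl
  ... | no 2≰1+b | _       = ⊥-elim (2≰1+b (s≤s 1≤b))
  ... | yes _    | no b≮n = ⊥-elim (b≮n b<n)

  net-sink : net (suc (suc n) , suc n) ≡ λ′ n ℚ.- λ′ 1
  net-sink with suc (suc n) ℕ.≟ 2 | ≡-dec ℕ._≟_ ℕ._≟_ (suc (suc n) , suc n) (n ℕ.+ 2 , n ℕ.+ 1)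
  ... | yes refl | yes _    = refl
  ... | no _     | yes _    = refl
  ... | _        | no ≢sink = ⊥-elim (≢sink (cong₂ _,_ (sym (n+2≡2+n n)) (sym (n+1≡1+n n))))

  net-zero : ∀ {a b} → a ≢ 2 → (a , b) ≢ (suc (suc n) , suc n) → net (a , b) ≡ 0ℚ
  net-zero {a} {b} a≢2 ≢sink with a ℕ.≟ 2 | ≡-dec ℕ._≟_ ℕ._≟_ (a , b) (n ℕ.+ 2 , n ℕ.+ 1)
  ... | yes a≡2 | _        = ⊥-elim (a≢2 a≡2)
  ... | no _    | yes sink = ⊥-elim (≢sink (trans sink (cong₂ _,_ (n+2≡2+n n) (n+1≡1+n n))))
  ... | no _    | no _     = refl

  net-interior : ∀ {a b} → 3 ℕ.≤ a → b ℕ.≤ n → net (a , b) ≡ 0ℚ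
  net-interior {a} {b} (s≤s (s≤s 1≤a)) b≤n =
    net-zero {a} {b} (λ { refl → case 1≤a of λ () }) (λ { refl → ℕP.1+n≰n b≤n })

  net-column : ∀ {a} → 3 ℕ.≤ a → a ℕ.≤ suc n → net (a , suc n) ≡ 0ℚ
  net-column {a} (s≤s (s≤s 1≤a)) a≤n+1 =
    net-zero {a} {suc n} (λ { refl → case 1≤a of λ () }) (λ { refl → ℕP.1+n≰n a≤n+1 })

  gtIndex : ℕ → ℕ → Maybe (GTIdx n)
  gtIndex a b with 1 ℕ.≤? a | a ℕ.≤? b | b ℕ.≤? n
  ... | yes 1≤a | yes a≤b | yes b≤n = just (gtIdx a b 1≤a a≤b b≤n)
  ... | _       | _       | _       = nothing

  entry : Pt (GTIdx n) → ℕ → ℕ → ℚ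
  entry x a b = coordinate (gtIndex a b) x

  entry-gtIdx : ∀ x {a b} 1≤a a≤b b≤n → entry x a b ≡ x (gtIdx a b 1≤a a≤b b≤n)
  entry-gtIdx x {a} {b} 1≤a a≤b b≤n with 1 ℕ.≤? a | a ℕ.≤? b | b ℕ.≤? n
  ... | yes p | yes q | yes r
    rewrite ℕP.≤-irrelevant p 1≤a | ℕP.≤-irrelevant q a≤b | ℕP.≤-irrelevant r b≤n = refl
  ... | no ¬p | _     | _     = ⊥-elim (¬p 1≤a)
  ... | yes _ | no ¬q | _     = ⊥-elim (¬q a≤b)
  ... | yes _ | yes _ | no ¬r = ⊥-elim (¬r b≤n)

  entry-at : ∀ x p → entry x (i p) (j p) ≡ x p
  entry-at x (gtIdx a b 1≤a a≤b b≤n) = entry-gtIdx x 1≤a a≤b b≤n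

  record IsGTArray (Y : ℕ → ℕ → ℚ) : Set where
    field
      nonneg              : ∀ {a b} → 1 ℕ.≤ a → a ℕ.≤ b → b ℕ.≤ n → 0ℚ ℚ.≤ Y a b
      first-row           : ∀ {b} → 1 ℕ.≤ b → b ℕ.≤ n → Y 1 b ≡ λ′ b
      diagonal-decreasing : ∀ {a b} → 1 ℕ.≤ a → a ℕ.≤ b → suc b ℕ.≤ n → Y (suc a) (suc b) ℚ.≤ Y a b
      column-increasing   : ∀ {a b} → 1 ℕ.≤ a → suc a ℕ.≤ b → b ℕ.≤ n → Y a b ℚ.≤ Y (suc a) b

    column-above-first : ∀ {a} → 1 ℕ.≤ a → a ℕ.≤ n → Y 1 n ℚ.≤ Y a n
    column-above-first {suc zero}    _ _   = ℚP.≤-refl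
    column-above-first {suc (suc a)} _ a≤n =
      ℚP.≤-trans (column-above-first (s≤s z≤n) (ℕP.≤-trans (ℕP.n≤1+n _) a≤n))
                 (column-increasing (s≤s z≤n) a≤n ℕP.≤-refl)

    diagonal-below-first : ∀ {a} → 1 ℕ.≤ a → a ℕ.≤ n → Y a a ℚ.≤ Y 1 1
    diagonal-below-first {suc zero}    _ _   = ℚP.≤-refl
    diagonal-below-first {suc (suc a)} _ a≤n =
      ℚP.≤-trans (diagonal-decreasing (s≤s z≤n) ℕP.≤-refl a≤n)
                 (diagonal-below-first (s≤s z≤n) (ℕP.≤-trans (ℕP.n≤1+n _) a≤n))

  GT⇒IsGTArray : ∀ {x} → GT λv x → IsGTArray (entry x)
  GT⇒IsGTArray {x} (nonneg , first-row , diagonal≤ , column≤) = record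
    { nonneg = λ 1≤a a≤b b≤n → subst (0ℚ ℚ.≤_) (sym (entry-gtIdx x 1≤a a≤b b≤n)) (nonneg _)
    ; first-row = λ 1≤b b≤n → trans (entry-gtIdx x (s≤s z≤n) 1≤b b≤n) (first-row _ refl)
    ; diagonal-decreasing = λ {a} {b} 1≤a a≤b b<n →
        subst₂ ℚ._≤_ (sym (entry-gtIdx x (s≤s z≤n) (s≤s a≤b) b<n))
                     (sym (entry-gtIdx x 1≤a a≤b (ℕP.<⇒≤ b<n)))
          (diagonal≤ (gtIdx a b 1≤a a≤b (ℕP.<⇒≤ b<n)) (gtIdx (suc a) (suc b) (s≤s z≤n) (s≤s a≤b) b<n) refl refl)
    ; column-increasing = λ {a} {b} 1≤a a<b b≤n →
        subst₂ ℚ._≤_ (sym (entry-gtIdx x 1≤a (ℕP.<⇒≤ a<b) b≤n))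
                     (sym (entry-gtIdx x (s≤s z≤n) a<b b≤n))
          (column≤ (gtIdx a b 1≤a (ℕP.<⇒≤ a<b) b≤n) (gtIdx (suc a) b (s≤s z≤n) a<b b≤n) refl refl)
    }

  IsGTArray⇒GT : ∀ {Y} → IsGTArray Y → GT λv (λ p → Y (i p) (j p))
  IsGTArray⇒GT {Y} isGT = (λ p → nonneg (1≤i p) (i≤j p) (j≤n p)) , first-row′ , diagonal≤ , column≤
    where
      open IsGTArray isGT
      first-row′ : ∀ p → i p ≡ 1 → Y (i p) (j p) ≡ ℕ→ℚ (part λv (j p))
      first-row′ (gtIdx _ _ _ 1≤b b≤n) refl = first-row 1≤b b≤n
      diagonal≤ : ∀ p q → i q ≡ suc (i p) → j q ≡ suc (j p) → Y (i q) (j q) ℚ.≤ Y (i p) (j p)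
      diagonal≤ (gtIdx _ _ 1≤a a≤b _) (gtIdx _ _ _ _ b<n) refl refl = diagonal-decreasing 1≤a a≤b b<n
      column≤ : ∀ p q → i q ≡ suc (i p) → j q ≡ j p → Y (i p) (j p) ℚ.≤ Y (i q) (j q)
      column≤ (gtIdx _ _ 1≤a _ _) (gtIdx _ _ _ a<b b≤n) refl refl = column-increasing 1≤a a<b b≤n

  extIndex : ℕ → ℕ → Maybe (GTIdx n)
  extIndex a b with b ℕ.≟ suc n | a ℕ.≟ suc b
  ... | yes _ | _     = gtIndex 1 n
  ... | no _  | yes _ = gtIndex 1 1
  ... | no _  | no _  = gtIndex a b

  ext : Pt (GTIdx n) → ℕ → ℕ → ℚ
  ext x a b = coordinate (extIndex a b) x

  ext-column : ∀ x a → ext x a (suc n) ≡ entry x 1 n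
  ext-column x a with suc n ℕ.≟ suc n
  ... | yes _ = refl
  ... | no ≢  = ⊥-elim (≢ refl)

  ext-diagonal : ∀ x {b} → b ℕ.≤ n → ext x (suc b) b ≡ entry x 1 1
  ext-diagonal x {b} b≤n with b ℕ.≟ suc n | suc b ℕ.≟ suc b
  ... | yes refl | _     = ⊥-elim (ℕP.1+n≰n b≤n)
  ... | no _     | yes _ = refl
  ... | no _     | no ≢  = ⊥-elim (≢ refl)

  ext-inner : ∀ x {a b} → a ℕ.≤ b → b ℕ.≤ n → ext x a b ≡ entry x a b
  ext-inner x {a} {b} a≤b b≤n with b ℕ.≟ suc n | a ℕ.≟ suc b
  ... | yes refl | _        = ⊥-elim (ℕP.1+n≰n b≤n)
  ... | no _     | yes refl = ⊥-elim (ℕP.1+n≰n a≤b)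
  ... | no _     | no _     = refl

  edgeEnds : Vtx × Vtx → Maybe (GTIdx n) × Maybe (GTIdx n)
  edgeEnds ((a , b) , (_ , b′)) with b′ ℕ.≟ b
  ... | yes _ = extIndex (a ∸ 1) (b ∸ 1) , extIndex a b
  ... | no _  = extIndex a b , extIndex (a ∸ 1) b

  edgeFlow : Pt (GTIdx n) → Vtx × Vtx → ℚ
  edgeFlow x ed = coordinate (proj₁ (edgeEnds ed)) x ℚ.- coordinate (proj₂ (edgeEnds ed)) x

  edgeFlow-↓ : ∀ x a b → edgeFlow x (↓ a b) ≡ ext x (a ∸ 1) (b ∸ 1) ℚ.- ext x a b
  edgeFlow-↓ x a b with b ℕ.≟ b
  ... | yes _ = refl
  ... | no ≢  = ⊥-elim (≢ refl)

  edgeFlow-↘ : ∀ x a b → edgeFlow x (↘ a b) ≡ ext x a b ℚ.- ext x (a ∸ 1) b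
  edgeFlow-↘ x a b with suc b ℕ.≟ b
  ... | yes 1+b≡b = ⊥-elim (ℕP.1+n≢n 1+b≡b)
  ... | no _      = refl

  toFlow : Pt (GTIdx n) → Pt (Fin #edges)
  toFlow x e = edgeFlow x (List.lookup edgeList e)

  flowAt-toFlow-↓ : ∀ x {a b} → Is↓ a b → flowAt (toFlow x) (↓ a b) ≡ ext x (a ∸ 1) (b ∸ 1) ℚ.- ext x a b
  flowAt-toFlow-↓ x {a} {b} edge =
    trans (flowAt-edge (edgeFlow x) (IsEdge⇒∈edgeList (down edge))) (edgeFlow-↓ x a b)

  flowAt-toFlow-↘ : ∀ x {a b} → Is↘ a b → flowAt (toFlow x) (↘ a b) ≡ ext x a b ℚ.- ext x (a ∸ 1) b
  flowAt-toFlow-↘ x {a} {b} edge =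
    trans (flowAt-edge (edgeFlow x) (IsEdge⇒∈edgeList (diag edge))) (edgeFlow-↘ x a b)

  Balanced : Pt (Fin #edges) → ℕ → ℕ → Set
  Balanced f a b = flowAt f (↓ a (suc b)) ℚ.+ flowAt f (↘ a b) ℚ.+ net (suc a , suc b)
                 ≡ flowAt f (↓ (suc a) (suc b)) ℚ.+ flowAt f (↘ (suc a) (suc b))

  Conserves : Pt (Fin #edges) → Set
  Conserves f = ∀ v → v ∈ vertexList → inflow f v ℚ.+ net v ≡ outflow f v

  Balanced⇒Conserves : ∀ {f} → (∀ {a b} → IsVertex (suc a , suc b) → Balanced f a b) → Conserves f
  Balanced⇒Conserves {f} balanced v v∈ = at (∈vertexList⇒IsVertex v∈)
    where
      at : ∀ {v} → IsVertex v → inflow f v ℚ.+ net v ≡ outflow f v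
      at {suc a , suc b} vertex =
        trans (cong (ℚ._+ net (suc a , suc b)) (inflow-split f a b)) (trans (balanced vertex) (sym (outflow-split f a b)))

  Conserves⇒Balanced : ∀ {f} → Conserves f → ∀ {a b} → IsVertex (suc a , suc b) → Balanced f a b
  Conserves⇒Balanced {f} conserves {a} {b} vertex =
    trans (cong (ℚ._+ net (suc a , suc b)) (sym (inflow-split f a b)))
          (trans (conserves _ (IsVertex⇒∈vertexList vertex)) (outflow-split f a b))

  balanced-by : ∀ f a b {p q r s t} →
    flowAt f (↓ a (suc b)) ≡ p → flowAt f (↘ a b) ≡ q → net (suc a , suc b) ≡ r →
    flowAt f (↓ (suc a) (suc b)) ≡ s → flowAt f (↘ (suc a) (suc b)) ≡ t →
    p ℚ.+ q ℚ.+ r ≡ s ℚ.+ t → Balanced f a b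
  balanced-by f a b refl refl refl refl refl balance = balance

  FirstRow : Pt (GTIdx n) → Set
  FirstRow x = ∀ {b} → 1 ℕ.≤ b → b ℕ.≤ n → entry x 1 b ≡ λ′ b

  source-balanced : ∀ {x} → FirstRow x → ∀ {b} → 1 ℕ.≤ b → suc b ℕ.≤ n → Balanced (toFlow x) 1 b
  source-balanced {x} row {b} 1≤b b<n =
    balanced-by (toFlow x) 1 b (flowAt-↓-source (toFlow x) (suc b)) (flowAt-↘-source (toFlow x) b)
      (net-source 1≤b b<n)
      (trans (flowAt-toFlow-↓ x (inj₁ (ℕP.≤-refl , s≤s 1≤b , b<n)))
             (cong (ℚ._- ext x 2 (suc b)) (trans (ext-inner x 1≤b (ℕP.<⇒≤ b<n)) (row 1≤b (ℕP.<⇒≤ b<n)))))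
      (trans (flowAt-toFlow-↘ x (inj₁ (ℕP.≤-refl , s≤s 1≤b , b<n)))
             (cong (λ q → ext x 2 (suc b) ℚ.- q) (trans (ext-inner x (s≤s z≤n) b<n) (row (s≤s z≤n) b<n))))
      (solve 3 (λ p q y → con 0ℚ :+ con 0ℚ :+ (p :- q) := (p :- y) :+ (y :- q)) refl
        (λ′ b) (λ′ (suc b)) (ext x 2 (suc b)))

  interior-balanced : ∀ x {a b} → suc (suc a) ℕ.≤ b → suc b ℕ.≤ n → Balanced (toFlow x) (suc (suc a)) b
  interior-balanced x {a} {b} a<b b<n =
    balanced-by (toFlow x) (suc (suc a)) b
      (flowAt-toFlow-↓ x (inj₁ (s≤s (s≤s z≤n) , ℕP.m≤n⇒m≤1+n a<b , b<n)))
      (flowAt-toFlow-↘ x (inj₁ (s≤s (s≤s z≤n) , a<b , ℕP.<⇒≤ b<n)))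
      (net-interior (s≤s (s≤s (s≤s z≤n))) b<n)
      (flowAt-toFlow-↓ x (inj₁ (s≤s (s≤s z≤n) , s≤s a<b , b<n)))
      (flowAt-toFlow-↘ x (inj₁ (s≤s (s≤s z≤n) , s≤s a<b , b<n)))
      (solve 4 (λ p q r s → (p :- q) :+ (r :- p) :+ con 0ℚ := (r :- s) :+ (s :- q)) refl
        (ext x (suc a) b) (ext x (suc (suc a)) (suc b)) (ext x (suc (suc a)) b) (ext x (suc (suc (suc a))) (suc b)))

  diagonal-balanced : ∀ x {b} → 1 ℕ.≤ b → suc b ℕ.≤ n → Balanced (toFlow x) (suc b) b
  diagonal-balanced x {b} 1≤b b<n =
    balanced-by (toFlow x) (suc b) b
      (flowAt-toFlow-↓ x (inj₁ (s≤s 1≤b , ℕP.≤-refl , b<n))) (↘-in 1≤b)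
      (net-interior (s≤s (s≤s 1≤b)) b<n)
      (flowAt-↓-below-diagonal (toFlow x) b)
      (trans (flowAt-toFlow-↘ x (inj₂ (refl , s≤s (s≤s 1≤b) , s≤s b<n)))
             (cong (ℚ._- ext x (suc b) (suc b)) (ext-diagonal x b<n)))
      (solve 3 (λ p q e → (p :- q) :+ (e :- p) :+ con 0ℚ := con 0ℚ :+ (e :- q)) refl
        (ext x b b) (ext x (suc b) (suc b)) (entry x 1 1))
    where
      ↘-in : 1 ℕ.≤ b → flowAt (toFlow x) (↘ (suc b) b) ≡ entry x 1 1 ℚ.- ext x b b
      ↘-in (s≤s {n = zero} z≤n) =
        trans (flowAt-↘-2-1 (toFlow x))
              (trans (sym (ℚP.+-inverseʳ (entry x 1 1)))
                     (cong (λ q → entry x 1 1 ℚ.- q) (sym (ext-inner x ℕP.≤-refl (ℕP.<⇒≤ b<n)))))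
      ↘-in (s≤s {n = suc _} z≤n) =
        trans (flowAt-toFlow-↘ x (inj₂ (refl , s≤s (s≤s (s≤s z≤n)) , s≤s (ℕP.<⇒≤ b<n))))
              (cong (ℚ._- ext x b b) (ext-diagonal x (ℕP.<⇒≤ b<n)))

  sink-balanced : ∀ {x} → FirstRow x → 1 ℕ.≤ n → Balanced (toFlow x) (suc n) n
  sink-balanced {x} row 1≤n with ℕP.m≤n⇒m<n∨m≡n 1≤n
  ... | inj₂ refl =
    balanced-by (toFlow x) 2 1 (flowAt-↓-2-column (toFlow x)) (flowAt-↘-2-1 (toFlow x)) net-sink
      (flowAt-↓-below-diagonal (toFlow x) 1) (flowAt-↘-beyond-column (toFlow x) 3)
      (solve 1 (λ l → con 0ℚ :+ con 0ℚ :+ (l :- l) := con 0ℚ :+ con 0ℚ) refl (λ′ 1))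
  ... | inj₁ 2≤n =
    balanced-by (toFlow x) (suc n) n
      (trans (flowAt-toFlow-↓ x (inj₂ (refl , s≤s 2≤n , ℕP.≤-refl)))
             (cong (λ q → ext x n n ℚ.- q) (trans (ext-column x (suc n)) (row 1≤n ℕP.≤-refl))))
      (trans (flowAt-toFlow-↘ x (inj₂ (refl , s≤s 2≤n , ℕP.≤-refl)))
             (cong (ℚ._- ext x n n) (trans (ext-diagonal x ℕP.≤-refl) (row ℕP.≤-refl 1≤n))))
      net-sink (flowAt-↓-below-diagonal (toFlow x) n) (flowAt-↘-beyond-column (toFlow x) (suc (suc n)))
      (solve 3 (λ p l₁ lₙ → (p :- lₙ) :+ (l₁ :- p) :+ (lₙ :- l₁) := con 0ℚ :+ con 0ℚ) refl
        (ext x n n) (λ′ 1) (λ′ n))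

  column-balanced : ∀ x {a} → 2 ℕ.≤ a → a ℕ.≤ n → Balanced (toFlow x) a n
  column-balanced x {a} 2≤a a≤n =
    balanced-by (toFlow x) a n (↓-in 2≤a) (flowAt-toFlow-↘ x (inj₁ (2≤a , a≤n , ℕP.≤-refl)))
      (net-column (s≤s 2≤a) (s≤s a≤n))
      (trans (flowAt-toFlow-↓ x (inj₂ (refl , s≤s 2≤a , s≤s a≤n)))
             (cong (λ q → ext x a n ℚ.- q) (ext-column x (suc a))))
      (flowAt-↘-beyond-column (toFlow x) (suc a))
      (solve 3 (λ p q e → (p :- e) :+ (q :- p) :+ con 0ℚ := (q :- e) :+ con 0ℚ) refl
        (ext x (a ∸ 1) n) (ext x a n) (entry x 1 n))
    where
      ↓-in : 2 ℕ.≤ a → flowAt (toFlow x) (↓ a (suc n)) ≡ ext x (a ∸ 1) n ℚ.- entry x 1 n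
      ↓-in (s≤s (s≤s {n = zero} z≤n)) =
        trans (flowAt-↓-2-column (toFlow x))
              (trans (sym (ℚP.+-inverseʳ (entry x 1 n)))
                     (cong (ℚ._- entry x 1 n) (sym (ext-inner x {1} {n} (ℕP.≤-trans (s≤s z≤n) (ℕP.≤-trans 2≤a a≤n)) ℕP.≤-refl))))
      ↓-in (s≤s (s≤s {n = suc _} z≤n)) =
        trans (flowAt-toFlow-↓ x (inj₂ (refl , s≤s (s≤s (s≤s z≤n)) , ℕP.m≤n⇒m≤1+n a≤n)))
              (cong (λ q → ext x (a ∸ 1) n ℚ.- q) (ext-column x a))

  toFlow-balanced : ∀ {x} → FirstRow x → ∀ {a b} → IsVertex (suc a , suc b) → Balanced (toFlow x) a b
  toFlow-balanced row (inner {suc zero}    _   1≤b b<n) = source-balanced row 1≤b b<n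
  toFlow-balanced row (inner {suc (suc a)} _   a<b b<n) = interior-balanced _ a<b b<n
  toFlow-balanced row (diagonal 1≤b b≤n) with ℕP.m≤n⇒m<n∨m≡n b≤n
  ... | inj₁ b<n  = diagonal-balanced _ 1≤b b<n
  ... | inj₂ refl = sink-balanced row 1≤b
  toFlow-balanced row (column 2≤a a≤n) = column-balanced _ 2≤a a≤n

  toFlow-nonneg : ∀ {x} → IsGTArray (entry x) → ∀ e → 0ℚ ℚ.≤ toFlow x e
  toFlow-nonneg {x} isGT e = edge-nonneg (∈edgeList⇒IsEdge (∈-lookup e))
    where
      open IsGTArray isGT
      0≤-by : ∀ {p q P Q} → p ≡ P → q ≡ Q → Q ℚ.≤ P → 0ℚ ℚ.≤ p ℚ.- q
      0≤-by refl refl Q≤P = p≤q⇒0≤q-p Q≤P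
      edge-nonneg : ∀ {ed} → IsEdge ed → 0ℚ ℚ.≤ edgeFlow x ed
      edge-nonneg (down (inj₁ (s≤s {n = suc a} (s≤s z≤n) , s≤s {n = b} a<b , b<n))) =
        subst (0ℚ ℚ.≤_) (sym (edgeFlow-↓ x (suc (suc a)) (suc b)))
          (0≤-by (ext-inner x a<b (ℕP.<⇒≤ b<n)) (ext-inner x (s≤s a<b) b<n)
                 (diagonal-decreasing (s≤s z≤n) a<b b<n))
      edge-nonneg (down {suc a} (inj₂ (refl , s≤s 2≤a , a≤n))) =
        subst (0ℚ ℚ.≤_) (sym (edgeFlow-↓ x (suc a) (suc n)))
          (0≤-by (ext-inner x (ℕP.≤-pred a≤n) ℕP.≤-refl) (ext-column x (suc a))
                 (column-above-first (ℕP.≤-trans (s≤s z≤n) 2≤a) (ℕP.≤-pred a≤n)))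
      edge-nonneg (diag {suc (suc a)} {b} (inj₁ (s≤s (s≤s z≤n) , a<b , b≤n))) =
        subst (0ℚ ℚ.≤_) (sym (edgeFlow-↘ x (suc (suc a)) b))
          (0≤-by (ext-inner x a<b b≤n) (ext-inner x (ℕP.<⇒≤ a<b) b≤n)
                 (column-increasing (s≤s z≤n) a<b b≤n))
      edge-nonneg (diag {suc b} (inj₂ (refl , s≤s 2≤b , b≤n))) =
        subst (0ℚ ℚ.≤_) (sym (edgeFlow-↘ x (suc b) b))
          (0≤-by (ext-diagonal x (ℕP.≤-pred b≤n)) (ext-inner x ℕP.≤-refl (ℕP.≤-pred b≤n))
                 (diagonal-below-first (ℕP.≤-trans (s≤s z≤n) 2≤b) (ℕP.≤-pred b≤n)))

  toFlow-maps : ∀ x → GT λv x → FlowPolytope (Gλ λv) (toFlow x)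
  toFlow-maps x x∈GT = toFlow-nonneg isGT , Balanced⇒Conserves (toFlow-balanced (IsGTArray.first-row isGT))
    where
      isGT : IsGTArray (entry x)
      isGT = GT⇒IsGTArray x∈GT

  -- Flows as Gelfand–Tsetlin patterns

  rebuild : Pt (Fin #edges) → ℕ → ℕ → ℚ
  rebuild f zero          b = 0ℚ
  rebuild f (suc zero)    b = λ′ b
  rebuild f (suc (suc a)) b = rebuild f (suc a) b ℚ.+ flowAt f (↘ (suc (suc a)) b)

  fromFlow : Pt (Fin #edges) → Pt (GTIdx n)
  fromFlow f p = rebuild f (i p) (j p)

  preserves-rebuild : ∀ a b → PreservesAffineCombinations (λ f → rebuild f a b)
  preserves-rebuild zero          b = preserves-const 0ℚ
  preserves-rebuild (suc zero)    b = preserves-const (λ′ b)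
  preserves-rebuild (suc (suc a)) b =
    preserves-sum (preserves-rebuild (suc a) b) (preserves-valueAt _≟ᴱ_ edgeList (↘ (suc (suc a)) b))

  rebuild-integral : ∀ {f} → IsIntegral f → ∀ a b → IsInt (rebuild f a b)
  rebuild-integral f∈ℤ zero          b = IsInt-0
  rebuild-integral f∈ℤ (suc zero)    b = IsInt-ℕ (part λv b)
  rebuild-integral f∈ℤ (suc (suc a)) b =
    IsInt-+ (rebuild-integral f∈ℤ (suc a) b) (valueAt-integral _≟ᴱ_ edgeList f∈ℤ (↘ (suc (suc a)) b))

  flowAt-↘-rebuild : ∀ f a b → flowAt f (↘ (suc (suc a)) b) ≡ rebuild f (suc (suc a)) b ℚ.- rebuild f (suc a) b
  flowAt-↘-rebuild f a b =
    solve 2 (λ r d → d := (r :+ d) :- r) refl (rebuild f (suc a) b) (flowAt f (↘ (suc (suc a)) b))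

  rebuild-toFlow : ∀ {x} → FirstRow x → ∀ {a b} → 1 ℕ.≤ a → a ℕ.≤ b → b ℕ.≤ n →
                   rebuild (toFlow x) a b ≡ entry x a b
  rebuild-toFlow row {suc zero} _ 1≤b b≤n = sym (row 1≤b b≤n)
  rebuild-toFlow {x} row {suc (suc a)} {b} _ a<b b≤n = begin
    rebuild (toFlow x) (suc a) b ℚ.+ flowAt (toFlow x) (↘ (suc (suc a)) b)
      ≡⟨ cong₂ ℚ._+_ (rebuild-toFlow row (s≤s z≤n) (ℕP.<⇒≤ a<b) b≤n)
                     (flowAt-toFlow-↘ x (inj₁ (s≤s (s≤s z≤n) , a<b , b≤n))) ⟩
    entry x (suc a) b ℚ.+ (ext x (suc (suc a)) b ℚ.- ext x (suc a) b)
      ≡⟨ cong₂ (λ p q → entry x (suc a) b ℚ.+ (p ℚ.- q)) (ext-inner x a<b b≤n) (ext-inner x (ℕP.<⇒≤ a<b) b≤n) ⟩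
    entry x (suc a) b ℚ.+ (entry x (suc (suc a)) b ℚ.- entry x (suc a) b)
      ≡⟨ solve 2 (λ p q → p :+ (q :- p) := q) refl (entry x (suc a) b) (entry x (suc (suc a)) b) ⟩
    entry x (suc (suc a)) b ∎
    where open ≡-Reasoning

  fromFlow∘toFlow : ∀ {x} → FirstRow x → fromFlow (toFlow x) ≐ x
  fromFlow∘toFlow {x} row p@(gtIdx a b 1≤a a≤b b≤n) = trans (rebuild-toFlow row 1≤a a≤b b≤n) (entry-at x p)

  module Reconstruction (f : Pt (Fin #edges)) (balanced : ∀ {a b} → IsVertex (suc a , suc b) → Balanced f a b) where

    private
      R : ℕ → ℕ → ℚ
      R = rebuild f

    ↓-out-by : ∀ {a b p q r t} → Balanced f a b →
      flowAt f (↓ a (suc b)) ≡ p → flowAt f (↘ a b) ≡ q → net (suc a , suc b) ≡ r →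
      flowAt f (↘ (suc a) (suc b)) ≡ t → flowAt f (↓ (suc a) (suc b)) ≡ p ℚ.+ q ℚ.+ r ℚ.- t
    ↓-out-by {a} {b} balance refl refl refl refl =
      trans (solve 2 (λ s t → s := (s :+ t) :- t) refl (flowAt f (↓ (suc a) (suc b))) (flowAt f (↘ (suc a) (suc b))))
            (cong (ℚ._- flowAt f (↘ (suc a) (suc b))) (sym balance))

    ↘-out-by : ∀ {a b p q r s} → Balanced f a b →
      flowAt f (↓ a (suc b)) ≡ p → flowAt f (↘ a b) ≡ q → net (suc a , suc b) ≡ r →
      flowAt f (↓ (suc a) (suc b)) ≡ s → flowAt f (↘ (suc a) (suc b)) ≡ p ℚ.+ q ℚ.+ r ℚ.- s
    ↘-out-by {a} {b} balance refl refl refl refl =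
      trans (solve 2 (λ s t → t := (s :+ t) :- s) refl (flowAt f (↓ (suc a) (suc b))) (flowAt f (↘ (suc a) (suc b))))
            (cong (ℚ._- flowAt f (↓ (suc a) (suc b))) (sym balance))

    flowAt-↓-inner : ∀ {a b} → Inner a b → flowAt f (↓ a b) ≡ R (a ∸ 1) (b ∸ 1) ℚ.- R a b
    flowAt-↓-inner (s≤s (s≤s {n = zero} z≤n) , s≤s {n = b} 1≤b , b<n) =
      trans (↓-out-by (balanced (inner ℕP.≤-refl 1≤b b<n)) (flowAt-↓-source f (suc b)) (flowAt-↘-source f b)
               (net-source 1≤b b<n) (flowAt-↘-rebuild f 0 (suc b)))
        (solve 3 (λ l l′ r → con 0ℚ :+ con 0ℚ :+ (l :- l′) :- (r :- l′) := l :- r) refl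
          (λ′ b) (λ′ (suc b)) (R 2 (suc b)))
    flowAt-↓-inner (s≤s (s≤s {n = suc a} z≤n) , s≤s {n = b} a<b , b<n) =
      trans (↓-out-by (balanced (inner (s≤s z≤n) a<b b<n))
               (flowAt-↓-inner (s≤s (s≤s z≤n) , ℕP.m≤n⇒m≤1+n a<b , b<n))
               (flowAt-↘-rebuild f a b)
               (net-interior (s≤s (s≤s (s≤s z≤n))) b<n)
               (flowAt-↘-rebuild f (suc a) (suc b)))
        (solve 4 (λ p q r s → (p :- q) :+ (r :- p) :+ con 0ℚ :- (s :- q) := r :- s) refl
          (R (suc a) b) (R (suc (suc a)) (suc b)) (R (suc (suc a)) b) (R (suc (suc (suc a))) (suc b)))

    flowAt-↓-column : ∀ {a} → 3 ℕ.≤ a → a ℕ.≤ suc n → flowAt f (↓ a (suc n)) ≡ R (a ∸ 1) n ℚ.- R 1 n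
    flowAt-↓-column (s≤s (s≤s (s≤s {n = zero} z≤n))) (s≤s a≤n) =
      trans (↓-out-by (balanced (column ℕP.≤-refl a≤n)) (flowAt-↓-2-column f) (flowAt-↘-rebuild f 0 n)
               (net-column ℕP.≤-refl (s≤s a≤n)) (flowAt-↘-beyond-column f 3))
        (solve 2 (λ q e → con 0ℚ :+ (q :- e) :+ con 0ℚ :- con 0ℚ := q :- e) refl (R 2 n) (R 1 n))
    flowAt-↓-column (s≤s (s≤s (s≤s {n = suc a} z≤n))) (s≤s a≤n) =
      trans (↓-out-by (balanced (column (s≤s (s≤s z≤n)) a≤n))
               (flowAt-↓-column (s≤s (s≤s (s≤s z≤n))) (ℕP.m≤n⇒m≤1+n a≤n)) (flowAt-↘-rebuild f (suc a) n)
               (net-column (s≤s (s≤s (s≤s z≤n))) (s≤s a≤n)) (flowAt-↘-beyond-column f (suc (suc (suc (suc a))))))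
        (solve 3 (λ p q e → (p :- e) :+ (q :- p) :+ con 0ℚ :- con 0ℚ := q :- e) refl
          (R (suc (suc a)) n) (R (suc (suc (suc a))) n) (R 1 n))

    flowAt-↘-diagonal : ∀ {b} → 2 ℕ.≤ b → b ℕ.≤ n → flowAt f (↘ (suc b) b) ≡ R 1 1 ℚ.- R b b
    flowAt-↘-diagonal (s≤s (s≤s {n = zero} z≤n)) b≤n =
      trans (↘-out-by (balanced (diagonal ℕP.≤-refl (ℕP.<⇒≤ b≤n)))
               (flowAt-↓-inner (ℕP.≤-refl , ℕP.≤-refl , b≤n)) (flowAt-↘-2-1 f)
               (net-interior ℕP.≤-refl b≤n) (flowAt-↓-below-diagonal f 1))
        (solve 2 (λ p q → (p :- q) :+ con 0ℚ :+ con 0ℚ :- con 0ℚ := p :- q) refl (R 1 1) (R 2 2))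
    flowAt-↘-diagonal {suc (suc (suc b))} (s≤s (s≤s {n = suc _} z≤n)) b≤n =
      trans (↘-out-by (balanced (diagonal (s≤s z≤n) (ℕP.<⇒≤ b≤n)))
               (flowAt-↓-inner (s≤s (s≤s z≤n) , ℕP.≤-refl , b≤n))
               (flowAt-↘-diagonal (s≤s (s≤s z≤n)) (ℕP.<⇒≤ b≤n))
               (net-interior (s≤s (s≤s (s≤s z≤n))) b≤n) (flowAt-↓-below-diagonal f (suc (suc b))))
        (solve 3 (λ p q e → (p :- q) :+ (e :- p) :+ con 0ℚ :- con 0ℚ := e :- q) refl
          (R (suc (suc b)) (suc (suc b))) (R (suc (suc (suc b))) (suc (suc (suc b)))) (R 1 1))

    entry-fromFlow : ∀ {a b} → 1 ℕ.≤ a → a ℕ.≤ b → b ℕ.≤ n → entry (fromFlow f) a b ≡ R a b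
    entry-fromFlow = entry-gtIdx (fromFlow f)

    ext-fromFlow : ∀ {a b} → 1 ℕ.≤ a → a ℕ.≤ b → b ℕ.≤ n → ext (fromFlow f) a b ≡ R a b
    ext-fromFlow 1≤a a≤b b≤n = trans (ext-inner (fromFlow f) a≤b b≤n) (entry-fromFlow 1≤a a≤b b≤n)

    edgeFlow-fromFlow : ∀ {ed} → IsEdge ed → edgeFlow (fromFlow f) ed ≡ flowAt f ed
    edgeFlow-fromFlow (down (inj₁ bounds@(s≤s {n = suc a} (s≤s z≤n) , s≤s {n = b} a<b , b<n))) =
      trans (edgeFlow-↓ (fromFlow f) (suc (suc a)) (suc b))
            (trans (cong₂ ℚ._-_ (ext-fromFlow (s≤s z≤n) a<b (ℕP.<⇒≤ b<n)) (ext-fromFlow (s≤s z≤n) (s≤s a<b) b<n))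
                   (sym (flowAt-↓-inner bounds)))
    edgeFlow-fromFlow (down {suc a} (inj₂ (refl , 3≤a+1@(s≤s 2≤a) , s≤s a≤n))) =
      trans (edgeFlow-↓ (fromFlow f) (suc a) (suc n))
            (trans (cong₂ ℚ._-_ (ext-fromFlow (ℕP.≤-trans (s≤s z≤n) 2≤a) a≤n ℕP.≤-refl)
                                (trans (ext-column (fromFlow f) (suc a))
                                       (entry-fromFlow ℕP.≤-refl (ℕP.≤-trans (s≤s z≤n) (ℕP.≤-trans 2≤a a≤n)) ℕP.≤-refl)))
                   (sym (flowAt-↓-column 3≤a+1 (s≤s a≤n))))
    edgeFlow-fromFlow (diag {j = b} (inj₁ (s≤s {n = suc a} (s≤s z≤n) , a<b , b≤n))) =
      trans (edgeFlow-↘ (fromFlow f) (suc (suc a)) b)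
            (trans (cong₂ ℚ._-_ (ext-fromFlow (s≤s z≤n) a<b b≤n) (ext-fromFlow (s≤s z≤n) (ℕP.<⇒≤ a<b) b≤n))
                   (sym (flowAt-↘-rebuild f a b)))
    edgeFlow-fromFlow (diag {suc b} (inj₂ (refl , s≤s 2≤b , s≤s b≤n))) =
      trans (edgeFlow-↘ (fromFlow f) (suc b) b)
            (trans (cong₂ ℚ._-_ (trans (ext-diagonal (fromFlow f) b≤n)
                                       (entry-fromFlow ℕP.≤-refl ℕP.≤-refl (ℕP.≤-trans (s≤s z≤n) (ℕP.≤-trans 2≤b b≤n))))
                                (ext-fromFlow (ℕP.≤-trans (s≤s z≤n) 2≤b) ℕP.≤-refl b≤n))
                   (sym (flowAt-↘-diagonal 2≤b b≤n)))

    toFlow∘fromFlow : toFlow (fromFlow f) ≐ f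
    toFlow∘fromFlow e = trans (edgeFlow-fromFlow (∈edgeList⇒IsEdge (∈-lookup e))) (flowAt-lookup f e)

    rebuild-IsGTArray : (∀ e → 0ℚ ℚ.≤ f e) → IsGTArray R
    rebuild-IsGTArray f≥0 = record
      { nonneg              = λ 1≤a _ _ → nonneg 1≤a
      ; first-row           = λ _ _ → refl
      ; diagonal-decreasing = λ 1≤a a≤b b<n →
          0≤q-p⇒p≤q (subst (0ℚ ℚ.≤_) (flowAt-↓-inner (s≤s 1≤a , s≤s a≤b , b<n)) (flowAt≥0 _))
      ; column-increasing   = λ { {suc a} _ _ _ → p≤p+q (flowAt≥0 _) }
      }
      where
        flowAt≥0 : ∀ ed → 0ℚ ℚ.≤ flowAt f ed
        flowAt≥0 = valueAt-nonneg _≟ᴱ_ edgeList f≥0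
        nonneg : ∀ {a b} → 1 ℕ.≤ a → 0ℚ ℚ.≤ R a b
        nonneg {suc zero}    {b} _ = 0≤ℕ→ℚ (part λv b)
        nonneg {suc (suc a)} {b} _ = 0≤p+q (nonneg {suc a} (s≤s z≤n)) (flowAt≥0 _)

  hull-FirstRow : ∀ {x} → AffineHull (GT λv) x → FirstRow x
  hull-FirstRow x∈hull {b} 1≤b b≤n =
    hull-preserves-equation (preserves-coordinate (gtIndex 1 b)) (preserves-const (λ′ b))
      (λ z z∈GT → IsGTArray.first-row (GT⇒IsGTArray z∈GT) 1≤b b≤n) x∈hull

  hull-Conserves : ∀ {f} → AffineHull (FlowPolytope (Gλ λv)) f → Conserves f
  hull-Conserves f∈hull v v∈ =
    hull-preserves-equation (preserves-sum (preserves-maskedSum #edges _) (preserves-const (net v)))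
      (preserves-maskedSum #edges _) (λ z z∈flows → proj₂ z∈flows v v∈) f∈hull

  fromFlow-maps : ∀ f → FlowPolytope (Gλ λv) f → GT λv (fromFlow f)
  fromFlow-maps f (f≥0 , conserves) =
    IsGTArray⇒GT (Reconstruction.rebuild-IsGTArray f (Conserves⇒Balanced conserves) f≥0)

  GT≅flows : IntegralAffineInverses (GT λv) (FlowPolytope (Gλ λv))
  GT≅flows = record
    { to            = toFlow
    ; from          = fromFlow
    ; to-affine     = λ e → preserves-difference (preserves-coordinate (proj₁ (ends e))) (preserves-coordinate (proj₂ (ends e)))
    ; from-affine   = λ p → preserves-rebuild (i p) (j p)
    ; to-integral   = λ x x∈ℤ e → IsInt-- (coordinate-integral (proj₁ (ends e)) x x∈ℤ)
                                          (coordinate-integral (proj₂ (ends e)) x x∈ℤ)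
    ; from-integral = λ f f∈ℤ p → rebuild-integral f∈ℤ (i p) (j p)
    ; to-maps       = toFlow-maps
    ; from-maps     = fromFlow-maps
    ; from∘to       = λ x x∈hull → fromFlow∘toFlow (hull-FirstRow x∈hull)
    ; to∘from       = λ f f∈hull → Reconstruction.toFlow∘fromFlow f (Conserves⇒Balanced (hull-Conserves f∈hull))
    }
    where
      ends : Fin #edges → Maybe (GTIdx n) × Maybe (GTIdx n)
      ends e = edgeEnds (List.lookup edgeList e)

theorem1p2 : (n : ℕ) (λv : Vec ℕ n) → IsPartition λv →
    IntegrallyEquivalent (GT λv) (FlowPolytope (Gλ λv))
theorem1p2 n λv _ = integrallyEquivalent (GelfandTsetlin.GT≅flows λv)
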